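{- $$F_{\{123,312\}}(x,q,z)=\frac{1+xz+(x^2-2q)z^2+(-x^2q+xq^2+3q^2)z^4+3q^3z^5-q^3z^6-4q^4z^7-2xq^4z^8}{(1-qz^2)^3(1-q^2z^3)}.$$
   Context: For permutations $\pi=\pi_1\cdots\pi_n\in\mathfrak{S}_n$ and $\sigma\in\mathfrak{S}_m$, $\pi$ contains $\sigma$ if there are indices $i_1<\dots<i_m$ such that $\pi_{i_1}\cdots\pi_{i_m}$ is in the same relative order as $\sigma$; otherwise $\pi$ avoids $\sigma$. For a set $\Sigma$ of patterns, $\mathfrak{S}_n(\Sigma)$ is the set of permutations in $\mathfrak{S}_n$ avoiding every pattern in $\Sigma$. $\mathrm{fp}(\pi)=|\{i:\pi_i=i\}|$, $\mathrm{exc}(\pi)=|\{i:\pi_i>i\}|$, and $F_\Sigma(x,q,z)=\sum_{n\ge0}\sum_{\pi\in\mathfrak{S}_n(\Sigma)}x^{\mathrm{fp}(\pi)}q^{\mathrm{exc}(\pi)}z^n$. -}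

module Defs where

open import Data.Bool using (Bool; true; false; _∧_; _∨_; not; if_then_else_)
open import Data.Nat as ℕ using (ℕ; zero; suc; _∸_; _<ᵇ_; _≡ᵇ_)
open import Data.Integer as ℤ using (ℤ; +_; -_; _+_; _*_; _^_)
open import Data.List using (List; []; _∷_; map; filter; length; zip; upTo; concatMap; foldr; applyUpTo)
open import Data.Bool.ListAction using (all; any)
open import Data.Product using (_×_; _,_)

-- Permutations of [n] = {1,…,n} in one-line notation, as lists of ℕ.

range : ℕ → List ℕ
range n = applyUpTo suc n

words : List ℕ → ℕ → List (List ℕ)
words as zero    = [] ∷ []
words as (suc k) = concatMap (λ a → map (a ∷_) (words as k)) as

elem : ℕ → List ℕ → Bool
elem a xs = any (λ b → a ≡ᵇ b) xs

-- a word of length n over [n] is a permutation iff it contains every i ∈ [n]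
isPerm : ℕ → List ℕ → Bool
isPerm n w = all (λ i → elem i w) (range n)

Sym : ℕ → List (List ℕ)
Sym n = filter (λ w → Data.Bool._≟_ (isPerm n w) true) (words (range n) n)
  where import Data.Bool

subseqs : List ℕ → List (List ℕ)
subseqs []       = [] ∷ []
subseqs (a ∷ as) = map (a ∷_) (subseqs as) Data.List.++ subseqs as
  where import Data.List

sameOrder : List ℕ → List ℕ → Bool
sameOrder u v =
  (length u ≡ᵇ length v) ∧
  all (λ p → all (λ r → agree p r) ps) ps
  where
    ps = zip u v
    agree : ℕ × ℕ → ℕ × ℕ → Bool
    agree (a , b) (c , d) = not ((a <ᵇ c) Data.Bool.xor (b <ᵇ d))
      where import Data.Bool

contains : List ℕ → List ℕ → Bool
contains π σ = any (sameOrder σ) (subseqs π)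

avoidsAll : List (List ℕ) → List ℕ → Bool
avoidsAll Σ π = all (λ σ → not (contains π σ)) Σ

SymAv : List (List ℕ) → ℕ → List (List ℕ)
SymAv Σ n = filter (λ π → Data.Bool._≟_ (avoidsAll Σ π) true) (Sym n)
  where import Data.Bool

-- Statistics (positions are 1-indexed).

countFrom : (ℕ → ℕ → Bool) → ℕ → List ℕ → ℕ
countFrom P i []       = 0
countFrom P i (a ∷ as) = (if P a i then 1 else 0) ℕ.+ countFrom P (suc i) as

fp : List ℕ → ℕ
fp = countFrom (λ a i → a ≡ᵇ i) 1

exc : List ℕ → ℕ
exc = countFrom (λ a i → i <ᵇ a) 1

-- Coefficient of zⁿ in F_Σ(x,q,z), evaluated at x,q ∈ ℤ:
--   Σ_{π ∈ 𝔖_n(Σ)} x^{fp π} q^{exc π}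
Fcoeff : List (List ℕ) → ℤ → ℤ → ℕ → ℤ
Fcoeff Σ x q n = foldr (λ π acc → (x ^ fp π) * (q ^ exc π) + acc) (+ 0) (SymAv Σ n)

-- Polynomials in z with ℤ coefficients as coefficient lists (constant first).

Poly : Set
Poly = List ℤ

coeff : Poly → ℕ → ℤ
coeff []       _       = + 0
coeff (c ∷ cs) zero    = c
coeff (c ∷ cs) (suc k) = coeff cs k

addP : Poly → Poly → Poly
addP []       qs       = qs
addP ps       []       = ps
addP (p ∷ ps) (q ∷ qs) = (p + q) ∷ addP ps qs

mulP : Poly → Poly → Poly
mulP []       qs = []
mulP (p ∷ ps) qs = addP (map (p *_) qs) (+ 0 ∷ mulP ps qs)

-- coefficient of zⁿ in the product of the polynomial P(z) and the power series Σ f(m) zᵐ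
seriesMulCoeff : Poly → (ℕ → ℤ) → ℕ → ℤ
seriesMulCoeff P f n = foldr _+_ (+ 0) (map (λ k → coeff P k * f (n ∸ k)) (Data.List.upTo (suc n)))
  where import Data.List

module Submission where

-- A permutation of [n] avoids 123 and 312 exactly when it is n ⋯ 1 or the word
-- (i+j ⋯ i+1)(n ⋯ i+j+1)(i ⋯ 1) with j, k ≥ 1 and i + j + k = n: the letters on either side
-- of n decrease, and those before it form an interval, since a letter after n lying strictly
-- between them would complete a 312. A decreasing run contributes x^fp q^exc according to how
-- far its values sit above or below its positions, so comparing i with j, k and j + k splits
-- the words into seven classes. Each class is a product of geometric families whose generating
-- functions have denominators 1 − q z² or 1 − q² z³, and the seven rational functions add up
-- to the stated one; that last polynomial identity is checked by normalising coefficients.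

open import Data.Integer using (ℤ)

module Lists where

  open import Data.Nat using (suc; _≤_; z≤n; s≤s)
  open import Data.Nat.Properties using (<-irrefl; ≤-reflexive; module ≤-Reasoning)
  open import Data.List using (List; []; _∷_; _++_; map; length; concatMap)
  open import Data.List.Membership.Propositional using (_∈_; _∉_; find)
  open import Data.List.Membership.Propositional.Properties
  open import Data.List.Relation.Unary.Any using (here; there)
  open import Data.List.Relation.Unary.All as All using (All)
  open import Data.List.Relation.Unary.AllPairs using (AllPairs; []; _∷_)
  open import Data.List.Relation.Unary.Unique.Propositional using (Unique)
  import Data.List.Relation.Unary.Unique.Propositional.Properties as Unique
  open import Data.List.Relation.Binary.Sublist.Propositional using (_⊆_; []; _∷_; _∷ʳ_; from∈; to∈)
  open import Data.List.Relation.Binary.Sublist.Propositional.Properties using (All-resp-⊆; ++⁺)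
  open import Data.Product using (_×_; _,_)
  open import Data.Sum using (_⊎_; inj₁; inj₂)
  open import Data.Empty using (⊥-elim)
  open import Function using (_∘_)
  open import Relation.Binary.PropositionalEquality

  private
    variable
      A B : Set

  AllPairs-resp-⊆ : ∀ {R : A → A → Set} {xs ys} → xs ⊆ ys → AllPairs R ys → AllPairs R xs
  AllPairs-resp-⊆ []          []       = []
  AllPairs-resp-⊆ (_ ∷ʳ xs⊆)  (_ ∷ rs) = AllPairs-resp-⊆ xs⊆ rs
  AllPairs-resp-⊆ (refl ∷ xs⊆) (r ∷ rs) = All-resp-⊆ xs⊆ r ∷ AllPairs-resp-⊆ xs⊆ rs

  AllPairs-pair : ∀ {R : A → A → Set} {x y ys} → x ∷ y ∷ [] ⊆ ys → AllPairs R ys → R x y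
  AllPairs-pair xy⊆ rs with r ∷ _ ← AllPairs-resp-⊆ xy⊆ rs = All.head r

  ∈-remove : ∀ {z a : A} p {s} → z ∈ p ++ a ∷ s → z ≢ a → z ∈ p ++ s
  ∈-remove []      (here z≡a) z≢a = ⊥-elim (z≢a z≡a)
  ∈-remove []      (there z∈) _   = z∈
  ∈-remove (_ ∷ p) (here z≡x) _   = here z≡x
  ∈-remove (_ ∷ p) (there z∈) z≢a = there (∈-remove p z∈ z≢a)

  length-remove : ∀ (p : List A) {a s} → length (p ++ a ∷ s) ≡ suc (length (p ++ s))
  length-remove []      = refl
  length-remove (_ ∷ p) = cong suc (length-remove p)

  length-≤ : ∀ {xs} (ys : List A) → Unique ys → (∀ {z} → z ∈ ys → z ∈ xs) → length ys ≤ length xs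
  length-≤ []       _              _   = z≤n
  length-≤ (y ∷ ys) (y∉ys ∷ uniq) ys⊆ with p , s , refl ← ∈-∃++ (ys⊆ (here refl)) =
    subst (suc (length ys) ≤_) (sym (length-remove p))
      (s≤s (length-≤ ys uniq (λ z∈ → ∈-remove p (ys⊆ (there z∈)) (λ { refl → All.lookup y∉ys z∈ refl }))))

  unique-without-repeats : ∀ (w : List A) → (∀ (p : List A) {a s} → w ≡ p ++ a ∷ s → a ∉ p ++ s) → Unique w
  unique-without-repeats []      _ = []
  unique-without-repeats (a ∷ w) norep =
    All.tabulate (λ { z∈ refl → norep [] refl z∈ })
    ∷ unique-without-repeats w (λ { p refl b∈ → norep (a ∷ p) refl (there b∈) })

  covering-unique : ∀ (w : List A) {ys} → Unique ys → (∀ {z} → z ∈ ys → z ∈ w) →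
                    length w ≤ length ys → Unique w
  covering-unique w {ys} uniq ys⊆w len = unique-without-repeats w repeat-free
    where
    repeat-free : ∀ p {a s} → w ≡ p ++ a ∷ s → a ∉ p ++ s
    repeat-free p {a} {s} refl a∈ = <-irrefl refl (begin-strict
      length ys           ≤⟨ length-≤ ys uniq ys⊆rest ⟩
      length (p ++ s)     <⟨ ≤-reflexive (sym (length-remove p {a} {s})) ⟩
      length w            ≤⟨ len ⟩
      length ys           ∎)
      where
      open ≤-Reasoning
      ys⊆rest : ∀ {z} → z ∈ ys → z ∈ p ++ s
      ys⊆rest z∈ with ∈-++⁻ p (ys⊆w z∈)
      ... | inj₁ z∈p         = ∈-++⁺ˡ z∈p
      ... | inj₂ (here refl) = a∈
      ... | inj₂ (there z∈s) = ∈-++⁺ʳ p z∈s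

  first-two : ∀ {x y z : A} → x ∷ y ∷ [] ⊆ x ∷ y ∷ z ∷ []
  first-two = refl ∷ refl ∷ _ ∷ʳ []

  pair-++ : ∀ {x y : A} xs {ys} → x ∷ y ∷ [] ⊆ xs ++ ys →
            x ∷ y ∷ [] ⊆ xs ⊎ (x ∈ xs × y ∈ ys) ⊎ x ∷ y ∷ [] ⊆ ys
  pair-++ []       xy⊆ = inj₂ (inj₂ xy⊆)
  pair-++ (_ ∷ xs) (_ ∷ʳ xy⊆) with pair-++ xs xy⊆
  ... | inj₁ xy⊆xs              = inj₁ (_ ∷ʳ xy⊆xs)
  ... | inj₂ (inj₁ (x∈ , y∈))   = inj₂ (inj₁ (there x∈ , y∈))
  ... | inj₂ (inj₂ xy⊆ys)       = inj₂ (inj₂ xy⊆ys)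
  pair-++ (_ ∷ xs) (refl ∷ y⊆) with ∈-++⁻ xs (to∈ y⊆)
  ... | inj₁ y∈xs = inj₁ (refl ∷ from∈ y∈xs)
  ... | inj₂ y∈ys = inj₂ (inj₁ (here refl , y∈ys))

  pair-⊆-++ : ∀ {x y : A} {xs ys} → x ∈ xs → y ∈ ys → x ∷ y ∷ [] ⊆ xs ++ ys
  pair-⊆-++ x∈ y∈ = ++⁺ (from∈ x∈) (from∈ y∈)

  concatMap-unique : ∀ (f : A → List B) (tag : B → A) {xs} → Unique xs → (∀ a → Unique (f a)) →
                     (∀ a {b} → b ∈ f a → tag b ≡ a) → Unique (concatMap f xs)
  concatMap-unique f tag []           _      _   = []
  concatMap-unique f tag (a∉ ∷ uniq) unique tagged =
    Unique.++⁺ (unique _) (concatMap-unique f tag uniq unique tagged) λ (b∈ , b∈rest) →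
      let a′ , a′∈ , b∈′ = find (∈-concatMap⁻ f b∈rest)
      in All.lookup a∉ a′∈ (trans (sym (tagged _ b∈)) (tagged a′ b∈′))

  unique-map : ∀ (f : A → B) (g : B → A) {xs} → (∀ {x} → x ∈ xs → g (f x) ≡ x) → Unique xs → Unique (map f xs)
  unique-map f g         g∘f≡ []          = []
  unique-map f g {x ∷ _} g∘f≡ (x∉ ∷ uniq) =
    All.tabulate (λ y∈ fx≡y → let x′ , x′∈ , y≡ = ∈-map⁻ f y∈ in
      All.lookup x∉ x′∈ (trans (sym (g∘f≡ (here refl))) (trans (cong g (trans fx≡y y≡)) (g∘f≡ (there x′∈)))))
    ∷ unique-map f g (g∘f≡ ∘ there) uniq

module Avoidance where

  open import Data.Nat using (ℕ; zero; suc; _≤_; _<_; _<ᵇ_; _≡ᵇ_; z≤n; s≤s)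
  open import Data.Nat.Properties
  import Data.Bool
  open import Data.Bool using (Bool; true; false; T; not; _xor_)
  open import Data.Bool.ListAction using (all)
  open import Data.Bool.Properties using (T-≡; T-∧; not-involutive)
  open import Data.List using (List; []; _∷_; map; length; zip)
  open import Data.List.Membership.Propositional using (_∈_; find; lose)
  open import Data.List.Membership.Propositional.Properties
  open import Data.List.Relation.Unary.Any as Any using (here; there)
  open import Data.List.Relation.Unary.All as All using (All)
  import Data.List.Relation.Unary.All.Properties as All
  import Data.List.Relation.Unary.Any.Properties as Any
  open import Data.List.Relation.Unary.Unique.Propositional using (Unique)
  import Data.List.Relation.Unary.Unique.Propositional.Properties as Unique
  open import Data.List.Relation.Binary.Sublist.Propositional using (_⊆_; []; _∷_; _∷ʳ_)
  open import Data.Product using (_×_; _,_; proj₁; proj₂; ∃)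
  open import Data.Sum using (inj₁; inj₂)
  open import Data.Empty using (⊥; ⊥-elim)
  open import Function using (_∘_; _⇔_; Equivalence; mk⇔)
  open import Relation.Binary.PropositionalEquality
  open import Defs

  open Equivalence using (to; from)

  Σ₀ : List (List ℕ)
  Σ₀ = (1 ∷ 2 ∷ 3 ∷ []) ∷ (3 ∷ 1 ∷ 2 ∷ []) ∷ []

  Avoids123 : List ℕ → Set
  Avoids123 w = ∀ {a b c} → a ∷ b ∷ c ∷ [] ⊆ w → a < b → b < c → ⊥

  Avoids312 : List ℕ → Set
  Avoids312 w = ∀ {a b c} → c ∷ a ∷ b ∷ [] ⊆ w → a < b → b < c → ⊥

  InRange : ℕ → ℕ → Set
  InRange n z = 1 ≤ z × z ≤ n

  record Avoider (n : ℕ) (w : List ℕ) : Set where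
    field
      length≡  : length w ≡ n
      bounded  : ∀ {z} → z ∈ w → InRange n z
      onto     : ∀ {z} → InRange n z → z ∈ w
      avoid123 : Avoids123 w
      avoid312 : Avoids312 w

  ∈-subseqs⁺ : ∀ {xs ys} → xs ⊆ ys → xs ∈ subseqs ys
  ∈-subseqs⁺ []             = here refl
  ∈-subseqs⁺ (_∷ʳ_ {ys = ys} y xs⊆ys) = ∈-++⁺ʳ (map (y ∷_) (subseqs ys)) (∈-subseqs⁺ xs⊆ys)
  ∈-subseqs⁺ (refl ∷ xs⊆ys) = ∈-++⁺ˡ (∈-map⁺ _ (∈-subseqs⁺ xs⊆ys))

  ∈-subseqs⁻ : ∀ {xs} ys → xs ∈ subseqs ys → xs ⊆ ys
  ∈-subseqs⁻ []       (here refl) = []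
  ∈-subseqs⁻ (y ∷ ys) xs∈ with ∈-++⁻ (map (y ∷_) (subseqs ys)) xs∈
  ... | inj₂ xs∈′ = y ∷ʳ ∈-subseqs⁻ ys xs∈′
  ... | inj₁ xs∈′ with ∈-map⁻ (y ∷_) xs∈′
  ...   | _ , zs∈ , refl = refl ∷ ∈-subseqs⁻ ys zs∈

  ∈-words⁺ : ∀ as k {w} → length w ≡ k → All (_∈ as) w → w ∈ words as k
  ∈-words⁺ as zero    {[]}    _   _             = here refl
  ∈-words⁺ as (suc k) {a ∷ w} len (a∈ All.∷ w∈) =
    ∈-concatMap⁺ (λ b → map (b ∷_) (words as k))
      (lose a∈ (∈-map⁺ (a ∷_) (∈-words⁺ as k (suc-injective len) w∈)))

  ∈-words⁻ : ∀ as k {w} → w ∈ words as k → length w ≡ k × All (_∈ as) w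
  ∈-words⁻ as zero    (here refl) = refl , All.[]
  ∈-words⁻ as (suc k) w∈
    with a , a∈ , w∈′ ← find (∈-concatMap⁻ (λ a → map (a ∷_) (words as k)) {xs = as} w∈)
    with w′ , w′∈ , refl ← ∈-map⁻ (a ∷_) w∈′
    = let len , w′⊆ = ∈-words⁻ as k w′∈ in cong suc len , a∈ All.∷ w′⊆

  ∈-range⁺ : ∀ {n z} → InRange n z → z ∈ range n
  ∈-range⁺ {z = suc z} (_ , z<n) = ∈-applyUpTo⁺ suc z<n

  ∈-range⁻ : ∀ {n z} → z ∈ range n → InRange n z
  ∈-range⁻ z∈ with _ , i<n , refl ← ∈-applyUpTo⁻ suc z∈ = s≤s z≤n , i<n

  range-unique : ∀ n → Unique (range n)
  range-unique n = Unique.applyUpTo⁺₁ suc n (λ i<j _ → <⇒≢ (s≤s i<j))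

  T-elem : ∀ {a xs} → T (elem a xs) ⇔ a ∈ xs
  T-elem {a} {xs} = mk⇔
    (λ t → Any.map (≡ᵇ⇒≡ a _) (Any.any⁻ (a ≡ᵇ_) xs t))
    (λ a∈ → Any.any⁺ (a ≡ᵇ_) (Any.map (λ { refl → ≡⇒≡ᵇ a a refl }) a∈))

  <ᵇ-true : ∀ {m n} → m < n → (m <ᵇ n) ≡ true
  <ᵇ-true m<n = to T-≡ (<⇒<ᵇ m<n)

  <ᵇ-false : ∀ {m n} → n ≤ m → (m <ᵇ n) ≡ false
  <ᵇ-false {m} {n} n≤m with m <ᵇ n in eq
  ... | false = refl
  ... | true  = ⊥-elim (<⇒≱ (<ᵇ⇒< m n (from T-≡ eq)) n≤m)

  agree : ℕ × ℕ → ℕ × ℕ → Bool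
  agree (i , a) (j , b) = not ((i <ᵇ j) xor (a <ᵇ b))

  sameOrder-agree : ∀ σ u → T (sameOrder σ u) → ∀ {p r} → p ∈ zip σ u → r ∈ zip σ u → T (agree p r)
  sameOrder-agree σ u t p∈ r∈ = All.lookup (All.all⁺ (agree _) (zip σ u) (All.lookup rows p∈)) r∈
    where rows = All.all⁺ (λ p → all (agree p) (zip σ u)) (zip σ u) (proj₂ (to T-∧ t))

  agree⇒< : ∀ {i j a b} → i < j → T (agree (i , a) (j , b)) → a < b
  agree⇒< {a = a} {b} i<j t rewrite <ᵇ-true i<j = <ᵇ⇒< a b (subst T (not-involutive _) t)

  sameOrder-123⁺ : ∀ {a b c} → a < b → b < c → T (sameOrder (1 ∷ 2 ∷ 3 ∷ []) (a ∷ b ∷ c ∷ []))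
  sameOrder-123⁺ {a} {b} {c} a<b b<c
    rewrite <ᵇ-false (≤-refl {a}) | <ᵇ-false (≤-refl {b}) | <ᵇ-false (≤-refl {c})
          | <ᵇ-true a<b | <ᵇ-true b<c | <ᵇ-true (<-trans a<b b<c)
          | <ᵇ-false (<⇒≤ a<b) | <ᵇ-false (<⇒≤ b<c) | <ᵇ-false (<⇒≤ (<-trans a<b b<c)) = _

  sameOrder-312⁺ : ∀ {a b c} → a < b → b < c → T (sameOrder (3 ∷ 1 ∷ 2 ∷ []) (c ∷ a ∷ b ∷ []))
  sameOrder-312⁺ {a} {b} {c} a<b b<c
    rewrite <ᵇ-false (≤-refl {a}) | <ᵇ-false (≤-refl {b}) | <ᵇ-false (≤-refl {c})
          | <ᵇ-true a<b | <ᵇ-true b<c | <ᵇ-true (<-trans a<b b<c)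
          | <ᵇ-false (<⇒≤ a<b) | <ᵇ-false (<⇒≤ b<c) | <ᵇ-false (<⇒≤ (<-trans a<b b<c)) = _

  sameOrder-123⁻ : ∀ u → T (sameOrder (1 ∷ 2 ∷ 3 ∷ []) u) →
                   ∃ λ a → ∃ λ b → ∃ λ c → u ≡ a ∷ b ∷ c ∷ [] × a < b × b < c
  sameOrder-123⁻ (a ∷ b ∷ c ∷ []) t = a , b , c , refl ,
    agree⇒< {1} {2} {a} {b} (s≤s (s≤s z≤n)) (agrees (here refl) (there (here refl))) ,
    agree⇒< {2} {3} {b} {c} (s≤s (s≤s (s≤s z≤n))) (agrees (there (here refl)) (there (there (here refl))))
    where agrees = sameOrder-agree (1 ∷ 2 ∷ 3 ∷ []) (a ∷ b ∷ c ∷ []) t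

  sameOrder-312⁻ : ∀ u → T (sameOrder (3 ∷ 1 ∷ 2 ∷ []) u) →
                   ∃ λ a → ∃ λ b → ∃ λ c → u ≡ c ∷ a ∷ b ∷ [] × a < b × b < c
  sameOrder-312⁻ (c ∷ a ∷ b ∷ []) t = a , b , c , refl ,
    agree⇒< {1} {2} {a} {b} (s≤s (s≤s z≤n)) (agrees (there (here refl)) (there (there (here refl)))) ,
    agree⇒< {2} {3} {b} {c} (s≤s (s≤s (s≤s z≤n))) (agrees (there (there (here refl))) (here refl))
    where agrees = sameOrder-agree (3 ∷ 1 ∷ 2 ∷ []) (c ∷ a ∷ b ∷ []) t

  T-not : ∀ {x} → T (not x) ⇔ (T x → ⊥)
  T-not {false} = mk⇔ (λ _ ()) (λ _ → _)
  T-not {true}  = mk⇔ (λ ()) (λ ¬t → ¬t _)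

  contains⇔ : ∀ {w σ} → T (contains w σ) ⇔ ∃ λ u → u ⊆ w × T (sameOrder σ u)
  contains⇔ {w} {σ} = mk⇔
    (λ t → let u , u∈ , so = find (Any.any⁻ (sameOrder σ) (subseqs w) t) in u , ∈-subseqs⁻ w u∈ , so)
    (λ (u , u⊆w , so) → Any.any⁺ (sameOrder σ) (lose (∈-subseqs⁺ u⊆w) so))

  avoids123⇔ : ∀ {w} → T (not (contains w (1 ∷ 2 ∷ 3 ∷ []))) ⇔ Avoids123 w
  avoids123⇔ {w} = mk⇔
    (λ t {_} {_} {_} abc⊆w a<b b<c →
      to T-not t (from (contains⇔ {w} {1 ∷ 2 ∷ 3 ∷ []}) (_ , abc⊆w , sameOrder-123⁺ a<b b<c)))
    (λ avoid → from T-not λ t →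
      let u , u⊆w , so = to (contains⇔ {w} {1 ∷ 2 ∷ 3 ∷ []}) t
          _ , _ , _ , u≡ , a<b , b<c = sameOrder-123⁻ u so
      in avoid (subst (_⊆ _) u≡ u⊆w) a<b b<c)

  avoids312⇔ : ∀ {w} → T (not (contains w (3 ∷ 1 ∷ 2 ∷ []))) ⇔ Avoids312 w
  avoids312⇔ {w} = mk⇔
    (λ t {_} {_} {_} cab⊆w a<b b<c →
      to T-not t (from (contains⇔ {w} {3 ∷ 1 ∷ 2 ∷ []}) (_ , cab⊆w , sameOrder-312⁺ a<b b<c)))
    (λ avoid → from T-not λ t →
      let u , u⊆w , so = to (contains⇔ {w} {3 ∷ 1 ∷ 2 ∷ []}) t
          _ , _ , _ , u≡ , a<b , b<c = sameOrder-312⁻ u so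
      in avoid (subst (_⊆ _) u≡ u⊆w) a<b b<c)

  ∈-SymAv⁻ : ∀ n {w} → w ∈ SymAv Σ₀ n → Avoider n w
  ∈-SymAv⁻ n {w} w∈ = record
    { length≡  = length≡
    ; bounded  = λ z∈ → ∈-range⁻ (All.lookup letters z∈)
    ; onto     = λ z-in →
        to T-elem (All.lookup (All.all⁺ (λ i → elem i w) (range n) (from T-≡ isPerm≡)) (∈-range⁺ z-in))
    ; avoid123 = to avoids123⇔ no123
    ; avoid312 = to avoids312⇔ no312
    }
    where
    w∈Sym,avoids = ∈-filter⁻ (λ π → avoidsAll Σ₀ π Data.Bool.≟ true) {xs = Sym n} w∈
    w∈words,isPerm = ∈-filter⁻ (λ v → isPerm n v Data.Bool.≟ true) {xs = words (range n) n} (proj₁ w∈Sym,avoids)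
    length≡ = proj₁ (∈-words⁻ (range n) n (proj₁ w∈words,isPerm))
    letters = proj₂ (∈-words⁻ (range n) n (proj₁ w∈words,isPerm))
    isPerm≡ = proj₂ w∈words,isPerm
    no123,no312 = to T-∧ (from T-≡ (proj₂ w∈Sym,avoids))
    no123 = proj₁ no123,no312
    no312 = proj₁ (to T-∧ (proj₂ no123,no312))

  ∈-SymAv⁺ : ∀ n {w} → Avoider n w → w ∈ SymAv Σ₀ n
  ∈-SymAv⁺ n {w} av =
    ∈-filter⁺ (λ π → avoidsAll Σ₀ π Data.Bool.≟ true)
      (∈-filter⁺ (λ v → isPerm n v Data.Bool.≟ true)
        (∈-words⁺ (range n) n length≡ (All.tabulate (∈-range⁺ ∘ bounded)))
        (to T-≡ (All.all⁻ (λ i → elem i w) (All.tabulate (from T-elem ∘ onto ∘ ∈-range⁻)))))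
      (to T-≡ (from T-∧ (from avoids123⇔ avoid123 , from T-∧ (from avoids312⇔ avoid312 , _))))
    where open Avoider av

module Blocks where

  open import Data.Nat using (ℕ; zero; suc; _+_; _≤_; _<_; _>_; z≤n; s≤s)
  open import Data.Nat.Properties
  open import Data.List using (List; []; _∷_; _++_; length; applyDownFrom; [_])
  open import Data.List.Properties using (length-++; length-applyDownFrom; length-applyUpTo; ++-identityʳ)
  open import Data.List.Membership.Propositional using (_∈_; _∉_)
  open import Data.List.Membership.Propositional.Properties
  open import Data.List.Relation.Unary.Any using (here; there)
  open import Data.List.Relation.Unary.All as All using (All; []; _∷_)
  open import Data.List.Relation.Unary.AllPairs using (AllPairs; []; _∷_; head)
  import Data.List.Relation.Unary.AllPairs.Properties as AllPairs
  open import Data.List.Relation.Unary.Unique.Propositional using (Unique)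
  import Data.List.Relation.Unary.Unique.Propositional.Properties as Unique
  open import Data.List.Relation.Binary.Sublist.Propositional
    using (_⊆_; []; _∷_; _∷ʳ_; from∈; to∈; ⊆-trans; ⊆-refl; minimum)
  open import Data.List.Relation.Binary.Sublist.Propositional.Properties
    using (All-resp-⊆; ++⁺; ++⁺ˡ; ++⁺ʳ; ∷ˡ⁻)
  open import Data.Product using (_×_; _,_; proj₁; proj₂; ∃)
  open import Data.Sum using (_⊎_; inj₁; inj₂; [_,_]′)
  open import Data.Empty using (⊥; ⊥-elim)
  open import Relation.Nullary using (yes; no)
  open import Relation.Binary.Definitions using (tri<; tri≈; tri>)
  open import Relation.Binary.PropositionalEquality
  open import Function using (_∘_; id; _⇔_; mk⇔; Equivalence)
  open import Data.List.Extrema.Nat using (min; argmin-sel; min≤⊤; min≤xs)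
  open Equivalence using (to; from)
  open Avoidance
  open Lists

  Decreasing : List ℕ → Set
  Decreasing = AllPairs _>_

  decreasing-⊆ : ∀ {xs x y} → Decreasing xs → x ∈ xs → y ∈ xs → y < x → x ∷ y ∷ [] ⊆ xs
  decreasing-⊆ (_ ∷ _)      (here refl) (here refl) y<x = ⊥-elim (<-irrefl refl y<x)
  decreasing-⊆ (_ ∷ _)      (here refl) (there y∈) _   = refl ∷ from∈ y∈
  decreasing-⊆ (x>xs ∷ _)   (there x∈)  (here refl) y<x = ⊥-elim (<-asym y<x (All.lookup x>xs x∈))
  decreasing-⊆ (_ ∷ dec)    (there x∈)  (there y∈) y<x = _ ∷ʳ decreasing-⊆ dec x∈ y∈ y<x

  decreasing-≡ : ∀ {xs ys} → Decreasing xs → Decreasing ys →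
                 (∀ {z} → z ∈ xs → z ∈ ys) → (∀ {z} → z ∈ ys → z ∈ xs) → xs ≡ ys
  decreasing-≡ {[]}     {[]}     _ _ _ _ = refl
  decreasing-≡ {[]}     {y ∷ _}  _ _ _ ys⊆ with () ← ys⊆ (here refl)
  decreasing-≡ {x ∷ _}  {[]}     _ _ xs⊆ _ with () ← xs⊆ (here refl)
  decreasing-≡ {x ∷ xs} {y ∷ ys} (x>xs ∷ dx) (y>ys ∷ dy) xs⊆ ys⊆ =
    cong₂ _∷_ x≡y (decreasing-≡ dx dy (tail⊆ xs⊆ x>xs x≡y) (tail⊆ ys⊆ y>ys (sym x≡y)))
    where
    x≡y : x ≡ y
    x≡y with xs⊆ (here refl) | ys⊆ (here refl)
    ... | here x≡y | _         = x≡y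
    ... | there _  | here y≡x  = sym y≡x
    ... | there x∈ | there y∈  = ⊥-elim (<-asym (All.lookup y>ys x∈) (All.lookup x>xs y∈))
    tail⊆ : ∀ {a b as bs} → (∀ {z} → z ∈ a ∷ as → z ∈ b ∷ bs) → All (_< a) as → a ≡ b →
            ∀ {z} → z ∈ as → z ∈ bs
    tail⊆ ⊆bs a>as refl z∈ with ⊆bs (there z∈)
    ... | here refl = ⊥-elim (<-irrefl refl (All.lookup a>as z∈))
    ... | there z∈′ = z∈′

  decreasing-if-no-ascent : ∀ {xs} → Unique xs → (∀ {x y} → x ∷ y ∷ [] ⊆ xs → x < y → ⊥) → Decreasing xs
  decreasing-if-no-ascent []                 _     = []
  decreasing-if-no-ascent {x ∷ _} (x∉ ∷ uniq) noAsc =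
    All.tabulate below ∷ decreasing-if-no-ascent uniq (noAsc ∘ (x ∷ʳ_))
    where
    below : ∀ {y} → y ∈ _ → y < x
    below {y} y∈ with <-cmp y x
    ... | tri< y<x _ _ = y<x
    ... | tri≈ _ y≡x _ = ⊥-elim (All.lookup x∉ y∈ (sym y≡x))
    ... | tri> _ _ x<y = ⊥-elim (noAsc (refl ∷ from∈ y∈) x<y)

  run : ℕ → ℕ → List ℕ
  run lo = applyDownFrom (λ t → suc (lo + t))

  ∈-run⁻ : ∀ {lo m z} → z ∈ run lo m → lo < z × z ≤ lo + m
  ∈-run⁻ {lo} z∈ with t , t<m , refl ← ∈-applyDownFrom⁻ (λ t → suc (lo + t)) z∈ =
    s≤s (m≤m+n lo t) , +-monoʳ-< lo t<m

  ∈-run⁺ : ∀ {lo m z} → lo < z → z ≤ lo + m → z ∈ run lo m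
  ∈-run⁺ {lo} (s≤s lo≤z) z≤ with t , refl ← m≤n⇒∃[o]m+o≡n lo≤z =
    ∈-applyDownFrom⁺ (λ t → suc (lo + t)) (+-cancelˡ-< lo _ _ z≤)

  run-decreasing : ∀ lo m → Decreasing (run lo m)
  run-decreasing lo m = AllPairs.applyDownFrom⁺₁ _ m (λ j<i _ → s≤s (+-monoʳ-< lo j<i))

  length-run : ∀ lo m → length (run lo m) ≡ m
  length-run lo = length-applyDownFrom _

  avoider-unique : ∀ {n w} → Avoider n w → Unique w
  avoider-unique {n} {w} av = covering-unique w (range-unique n)
    (onto ∘ ∈-range⁻)
    (≤-reflexive (trans length≡ (sym (length-applyUpTo suc n))))
    where open Avoider av

  Triple : Set
  Triple = ℕ × ℕ × ℕ

  blocks : Triple → List ℕ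
  blocks (i , j , k) = run i j ++ run (i + j) k ++ run 0 i

  data Valid (n : ℕ) : Triple → Set where
    descending  : Valid n (0 , 0 , n)
    threeBlocks : ∀ {i j k} → i + suc j + suc k ≡ n → Valid n (i , suc j , suc k)

  valid-sum : ∀ {n i j k} → Valid n (i , j , k) → i + j + k ≡ n
  valid-sum descending       = refl
  valid-sum (threeBlocks eq) = eq

  module _ {i j k : ℕ} where

    private
      descent : ∀ {lo m x y} → x ∷ y ∷ [] ⊆ run lo m → x < y → ⊥
      descent xy⊆ x<y = <-asym x<y (AllPairs-pair xy⊆ (run-decreasing _ _))

    blocks-ascent : ∀ {x y} → x ∷ y ∷ [] ⊆ blocks (i , j , k) → x < y → i < x × x ≤ i + j × i + j < y
    blocks-ascent xy⊆ x<y with pair-++ (run i j) xy⊆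
    ... | inj₁ xy⊆₁ = ⊥-elim (descent xy⊆₁ x<y)
    ... | inj₂ (inj₁ (x∈₁ , y∈₂₃)) with ∈-++⁻ (run (i + j) k) y∈₂₃
    ...   | inj₁ y∈₂ = proj₁ (∈-run⁻ x∈₁) , proj₂ (∈-run⁻ x∈₁) , proj₁ (∈-run⁻ y∈₂)
    ...   | inj₂ y∈₃ = ⊥-elim (<-asym x<y (≤-<-trans (proj₂ (∈-run⁻ y∈₃)) (proj₁ (∈-run⁻ x∈₁))))
    blocks-ascent xy⊆ x<y | inj₂ (inj₂ xy⊆₂₃) with pair-++ (run (i + j) k) xy⊆₂₃
    ... | inj₁ xy⊆₂ = ⊥-elim (descent xy⊆₂ x<y)
    ... | inj₂ (inj₁ (x∈₂ , y∈₃)) =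
      ⊥-elim (<-asym x<y (≤-<-trans (proj₂ (∈-run⁻ y∈₃)) (≤-<-trans (m≤m+n i j) (proj₁ (∈-run⁻ x∈₂)))))
    ... | inj₂ (inj₂ xy⊆₃) = ⊥-elim (descent xy⊆₃ x<y)

    blocks-before-first : ∀ {x y} → x ∷ y ∷ [] ⊆ blocks (i , j , k) → i < y → y ≤ i + j → x ≤ i + j
    blocks-before-first xy⊆ i<y y≤ with pair-++ (run i j) xy⊆
    ... | inj₁ xy⊆₁              = proj₂ (∈-run⁻ (to∈ xy⊆₁))
    ... | inj₂ (inj₁ (x∈₁ , _))  = proj₂ (∈-run⁻ x∈₁)
    ... | inj₂ (inj₂ xy⊆₂₃) with ∈-++⁻ (run (i + j) k) (to∈ (∷ˡ⁻ xy⊆₂₃))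
    ...   | inj₁ y∈₂ = ⊥-elim (<⇒≱ (proj₁ (∈-run⁻ y∈₂)) y≤)
    ...   | inj₂ y∈₃ = ⊥-elim (<⇒≱ i<y (proj₂ (∈-run⁻ y∈₃)))

    blocks-avoids123 : Avoids123 (blocks (i , j , k))
    blocks-avoids123 abc⊆ a<b b<c =
      <⇒≱ (proj₂ (proj₂ (blocks-ascent (⊆-trans first-two abc⊆) a<b)))
          (proj₁ (proj₂ (blocks-ascent (∷ˡ⁻ abc⊆) b<c)))

    blocks-avoids312 : Avoids312 (blocks (i , j , k))
    blocks-avoids312 cab⊆ a<b b<c =
      let i<a , a≤ , <b = blocks-ascent (∷ˡ⁻ cab⊆) a<b
      in <-asym b<c (≤-<-trans (blocks-before-first (⊆-trans first-two cab⊆) i<a a≤) <b)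

  blocks-avoider : ∀ {n i j k} → i + j + k ≡ n → Avoider n (blocks (i , j , k))
  blocks-avoider {n} {i} {j} {k} refl = record
    { length≡  = length≡
    ; bounded  = bounded
    ; onto     = onto
    ; avoid123 = blocks-avoids123 {i} {j} {k}
    ; avoid312 = blocks-avoids312 {i} {j} {k}
    }
    where
    length≡ : length (blocks (i , j , k)) ≡ i + j + k
    length≡ = begin
      length (run i j ++ run (i + j) k ++ run 0 i)            ≡⟨ length-++ (run i j) ⟩
      length (run i j) + length (run (i + j) k ++ run 0 i)    ≡⟨ cong (length (run i j) +_) (length-++ (run (i + j) k)) ⟩
      length (run i j) + (length (run (i + j) k) + length (run 0 i))
        ≡⟨ cong₂ _+_ (length-run i j) (cong₂ _+_ (length-run (i + j) k) (length-run 0 i)) ⟩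
      j + (k + i)                                             ≡⟨ cong (j +_) (+-comm k i) ⟩
      j + (i + k)                                             ≡⟨ +-assoc j i k ⟨
      j + i + k                                               ≡⟨ cong (_+ k) (+-comm j i) ⟩
      i + j + k                                               ∎
      where open ≡-Reasoning

    i+j≤n : i + j ≤ i + j + k
    i+j≤n = m≤m+n (i + j) k

    bounded : ∀ {z} → z ∈ blocks (i , j , k) → InRange (i + j + k) z
    bounded z∈ with ∈-++⁻ (run i j) z∈
    ... | inj₁ z∈₁ = let i<z , z≤ = ∈-run⁻ z∈₁ in ≤-trans (s≤s z≤n) i<z , ≤-trans z≤ i+j≤n
    ... | inj₂ z∈₂₃ with ∈-++⁻ (run (i + j) k) z∈₂₃
    ...   | inj₁ z∈₂ = let i+j<z , z≤ = ∈-run⁻ z∈₂ in ≤-trans (s≤s z≤n) i+j<z , z≤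
    ...   | inj₂ z∈₃ = let 0<z , z≤i = ∈-run⁻ z∈₃ in 0<z , ≤-trans z≤i (≤-trans (m≤m+n i j) i+j≤n)

    onto : ∀ {z} → InRange (i + j + k) z → z ∈ blocks (i , j , k)
    onto {z} (0<z , z≤ijk) with z ≤? i | z ≤? i + j
    ... | yes z≤i | _        = ∈-++⁺ʳ (run i j) (∈-++⁺ʳ (run (i + j) k) (∈-run⁺ 0<z z≤i))
    ... | no  z≰i | yes z≤ = ∈-++⁺ˡ (∈-run⁺ (≰⇒> z≰i) z≤)
    ... | no  _   | no  z≰ = ∈-++⁺ʳ (run i j) (∈-++⁺ˡ (∈-run⁺ (≰⇒> z≰) z≤ijk))

  module AroundMax {m} (u v : List ℕ) (av : Avoider (suc m) (u ++ suc m ∷ v)) where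

    open Avoider av

    private
      uniq : Unique (u ++ suc m ∷ v)
      uniq = avoider-unique av

    below-max : ∀ {z} → z ∈ u ++ suc m ∷ v → z ≢ suc m → z ≤ m
    below-max z∈ z≢ = ≤-pred (≤∧≢⇒< (proj₂ (bounded z∈)) z≢)

    u-below-max : ∀ {z} → z ∈ u → z ≤ m
    u-below-max z∈ = below-max (∈-++⁺ˡ z∈) (AllPairs-pair (pair-⊆-++ z∈ (here refl)) uniq)

    v-below-max : ∀ {z} → z ∈ v → z ≤ m
    v-below-max z∈ = below-max (∈-++⁺ʳ u (there z∈)) (≢-sym (AllPairs-pair (++⁺ˡ u (refl ∷ from∈ z∈)) uniq))

    u∩v : ∀ {z} → z ∈ u → z ∈ v → ⊥
    u∩v z∈u z∈v = AllPairs-pair (pair-⊆-++ z∈u (there z∈v)) uniq refl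

    u∪v : ∀ {z} → InRange m z → z ∈ u ⊎ z ∈ v
    u∪v (1≤z , z≤m) with ∈-++⁻ u (onto (1≤z , ≤-trans z≤m (n≤1+n m)))
    ... | inj₁ z∈u         = inj₁ z∈u
    ... | inj₂ (here refl) = ⊥-elim (1+n≰n z≤m)
    ... | inj₂ (there z∈v) = inj₂ z∈v

    -- A prefix ascent before the maximum would be a 123, a suffix ascent after it a 312.
    u-decreasing : Decreasing u
    u-decreasing = decreasing-if-no-ascent (AllPairs-resp-⊆ (++⁺ʳ _ ⊆-refl) uniq)
      (λ ab⊆ a<b → avoid123 (++⁺ ab⊆ (refl ∷ minimum v)) a<b (s≤s (u-below-max (to∈ (∷ˡ⁻ ab⊆)))))

    v-decreasing : Decreasing v
    v-decreasing = decreasing-if-no-ascent (AllPairs-resp-⊆ (++⁺ˡ u (_ ∷ʳ ⊆-refl)) uniq)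
      (λ ab⊆ a<b → avoid312 (++⁺ˡ u (refl ∷ ab⊆)) a<b (s≤s (v-below-max (to∈ (∷ˡ⁻ ab⊆)))))

    module _ {a b} (a∈ : a ∈ u) (b∈ : b ∈ u) (u-bounds : ∀ {z} → z ∈ u → b ≤ z × z ≤ a) where

      -- A value strictly between b and a lying after the maximum would form a 312 with a and b.
      u-interval : ∀ {z} → b ≤ z → z ≤ a → z ∈ u
      u-interval {z} b≤z z≤a
        with u∪v (≤-trans (proj₁ (bounded (∈-++⁺ˡ b∈))) b≤z , ≤-trans z≤a (u-below-max a∈))
      ... | inj₁ z∈u = z∈u
      ... | inj₂ z∈v with m≤n⇒m<n∨m≡n b≤z | m≤n⇒m<n∨m≡n z≤a
      ...   | inj₂ refl | _         = ⊥-elim (u∩v b∈ z∈v)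
      ...   | _         | inj₂ refl = ⊥-elim (u∩v a∈ z∈v)
      ...   | inj₁ b<z  | inj₁ z<a  =
        ⊥-elim (avoid312 (++⁺ (decreasing-⊆ u-decreasing a∈ b∈ (<-trans b<z z<a)) (from∈ (there z∈v))) b<z z<a)

      u-members : ∀ {z} → z ∈ u ⇔ (b ≤ z × z ≤ a)
      u-members = mk⇔ u-bounds (λ (b≤z , z≤a) → u-interval b≤z z≤a)

      v-members : ∀ {z} → z ∈ v ⇔ (a < z × z ≤ m ⊎ 1 ≤ z × z < b)
      v-members {z} = mk⇔ outside inside
        where
        outside : z ∈ v → a < z × z ≤ m ⊎ 1 ≤ z × z < b
        outside z∈v with b ≤? z | z ≤? a
        ... | yes b≤z | yes z≤a = ⊥-elim (u∩v (u-interval b≤z z≤a) z∈v)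
        ... | no  b≰z | _       = inj₂ (proj₁ (bounded (∈-++⁺ʳ u (there z∈v))) , ≰⇒> b≰z)
        ... | yes _   | no  z≰a = inj₁ (≰⇒> z≰a , v-below-max z∈v)
        inside : a < z × z ≤ m ⊎ 1 ≤ z × z < b → z ∈ v
        inside (inj₁ (a<z , z≤m)) with u∪v (≤-trans (s≤s z≤n) a<z , z≤m)
        ... | inj₁ z∈u = ⊥-elim (<⇒≱ a<z (proj₂ (u-bounds z∈u)))
        ... | inj₂ z∈v = z∈v
        inside (inj₂ (1≤z , z<b)) with u∪v (1≤z , <⇒≤ (<-≤-trans z<b (u-below-max b∈)))
        ... | inj₁ z∈u = ⊥-elim (<⇒≱ z<b (proj₁ (u-bounds z∈u)))
        ... | inj₂ z∈v = z∈v

  blocks-from-intervals : ∀ {m a b u v} → 1 ≤ b → b ≤ a → a ≤ m → Decreasing u → Decreasing v →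
    (∀ {z} → z ∈ u ⇔ (b ≤ z × z ≤ a)) → (∀ {z} → z ∈ v ⇔ (a < z × z ≤ m ⊎ 1 ≤ z × z < b)) →
    ∃ λ t → Valid (suc m) t × u ++ suc m ∷ v ≡ blocks t
  blocks-from-intervals {m} {a} {u = u} {v} 1≤b b≤a a≤m u↓ v↓ u-mem v-mem
    with i , refl ← m≤n⇒∃[o]m+o≡n 1≤b
    with j , refl ← m≤n⇒∃[o]m+o≡n (≤-trans (n≤1+n i) b≤a)
    with j
  ... | zero = ⊥-elim (1+n≰n (subst (suc i ≤_) (+-identityʳ i) b≤a))
  ... | suc j′ with k , refl ← m≤n⇒∃[o]m+o≡n a≤m =
    (i , suc j′ , suc k) , threeBlocks (+-suc (i + suc j′) k) , cong₂ _++_ u≡ (cong (suc m ∷_) v≡)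
    where
    u≡ : u ≡ run i (suc j′)
    u≡ = decreasing-≡ u↓ (run-decreasing i (suc j′))
      (λ z∈ → let i<z , z≤a = to u-mem z∈ in ∈-run⁺ i<z z≤a) (from u-mem ∘ ∈-run⁻)
    high>low : All (λ x → All (_< x) (run 0 i)) (run (i + suc j′) k)
    high>low = All.tabulate λ x∈ → All.tabulate λ y∈ →
      ≤-<-trans (proj₂ (∈-run⁻ y∈)) (≤-<-trans (m≤m+n i (suc j′)) (proj₁ (∈-run⁻ x∈)))
    v≡ : v ≡ run (i + suc j′) k ++ run 0 i
    v≡ = decreasing-≡ v↓ (AllPairs.++⁺ (run-decreasing _ k) (run-decreasing 0 i) high>low) into outof
      where
      into : ∀ {z} → z ∈ v → z ∈ run (i + suc j′) k ++ run 0 i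
      into z∈ with to v-mem z∈
      ... | inj₁ (a<z , z≤m) = ∈-++⁺ˡ (∈-run⁺ a<z z≤m)
      ... | inj₂ (1≤z , z<b) = ∈-++⁺ʳ (run _ k) (∈-run⁺ 1≤z (≤-pred z<b))
      outof : ∀ {z} → z ∈ run (i + suc j′) k ++ run 0 i → z ∈ v
      outof z∈ with ∈-++⁻ (run _ k) z∈
      ... | inj₁ z∈high = from v-mem (inj₁ (∈-run⁻ z∈high))
      ... | inj₂ z∈low  = let 0<z , z≤i = ∈-run⁻ z∈low in from v-mem (inj₂ (0<z , s≤s z≤i))

  split-at-max : ∀ {m u v} → Avoider (suc m) (u ++ suc m ∷ v) → ∃ λ t → Valid (suc m) t × u ++ suc m ∷ v ≡ blocks t
  split-at-max {m} {[]} {v} av =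
    (0 , 0 , suc m) , descending , cong (suc m ∷_) (trans v≡ (sym (++-identityʳ (run 0 m))))
    where
    open AroundMax [] v av
    v≡ : v ≡ run 0 m
    v≡ = decreasing-≡ v-decreasing (run-decreasing 0 m)
      (λ z∈ → ∈-run⁺ (proj₁ (Avoider.bounded av (there z∈))) (v-below-max z∈))
      (λ z∈ → [ (λ ()) , id ]′ (u∪v (∈-run⁻ z∈)))
  split-at-max {m} {a ∷ u′} {v} av =
    blocks-from-intervals 1≤b b≤a (u-below-max (here refl)) u-decreasing v-decreasing
      (u-members (here refl) b∈ bounds) (v-members (here refl) b∈ bounds)
    where
    open AroundMax (a ∷ u′) v av
    b = min a u′
    b∈ : b ∈ a ∷ u′
    b∈ = [ here , there ]′ (argmin-sel id a u′)
    bounds : ∀ {z} → z ∈ a ∷ u′ → b ≤ z × z ≤ a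
    bounds (here refl) = min≤⊤ a u′ , ≤-refl
    bounds (there z∈)  = All.lookup (min≤xs a u′) z∈ , <⇒≤ (All.lookup (head u-decreasing) z∈)
    1≤b : 1 ≤ b
    1≤b = proj₁ (Avoider.bounded av (∈-++⁺ˡ b∈))
    b≤a : b ≤ a
    b≤a = min≤⊤ a u′

  avoider⇒blocks : ∀ {n w} → Avoider n w → ∃ λ t → Valid n t × w ≡ blocks t
  avoider⇒blocks {zero}  {[]}    _  = (0 , 0 , 0) , descending , refl
  avoider⇒blocks {zero}  {_ ∷ _} av with () ← Avoider.length≡ av
  avoider⇒blocks {suc m} {w}     av with u , v , refl ← ∈-∃++ (Avoider.onto av (s≤s z≤n , ≤-refl)) =
    split-at-max av

module Classes where

  open import Data.Nat using (ℕ; zero; suc; _+_; _*_; _≤_; _<_; _≤ᵇ_; _≡ᵇ_; s≤s)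
  open import Data.Nat.Properties
  open import Data.Bool using (true; false; if_then_else_)
  open import Data.Bool.Properties using (T-≡)
  open import Data.List using (List; []; _∷_; _++_; map; length; concatMap)
  open import Data.List.Membership.Propositional using (_∈_; find; lose)
  open import Data.List.Membership.Propositional.Properties
  open import Data.List.Relation.Unary.Any using (here; there)
  open import Data.List.Relation.Unary.All as All using (All)
  open import Data.List.Relation.Unary.Unique.Propositional using (Unique; []; _∷_)
  import Data.List.Relation.Unary.Unique.Propositional.Properties as Unique
  import Data.Vec
  open import Data.Vec using (Vec; []; _∷_)
  open import Data.List.Relation.Binary.Disjoint.Propositional using (Disjoint)
  open import Data.Product using (_×_; _,_; proj₂; ∃; ∃₂)
  open import Data.Sum using ([_,_]′)
  open import Data.Empty using (⊥-elim)
  open import Function using (_∘_; Equivalence)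
  open import Relation.Nullary using (yes; no)
  open import Relation.Binary.PropositionalEquality
  open import Data.Nat.Tactic.RingSolver using (solve-∀)
  open Blocks using (Triple; Valid; descending; threeBlocks; valid-sum)
  open Lists using (concatMap-unique)

  open Equivalence using (to; from)

  data Kind : Set where
    geom₂ geom₃ : Kind
    dec         : ℕ → Kind

  degree : Kind → ℕ → ℕ
  degree geom₂   a = 2 * a
  degree geom₃   a = 3 * a
  degree (dec _) a = a

  Exponents : List Kind → Set
  Exponents ks = Vec ℕ (length ks)

  deg : ∀ ks → Exponents ks → ℕ
  deg []       []      = 0
  deg (k ∷ ks) (a ∷ e) = degree k a + deg ks e

  bump : ∀ {r} → Vec ℕ (suc r) → Vec ℕ (suc r)
  bump (a ∷ e) = suc a ∷ e

  bump₂ : ∀ {r} → Vec ℕ (suc r) → Vec ℕ (suc r)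
  bump₂ (a ∷ e) = suc (suc a) ∷ e

  -- All exponent vectors of total degree n, generated along the recurrences of the kinds.
  vectors : ∀ ks → ℕ → List (Exponents ks)
  vectors []            zero                = [] ∷ []
  vectors []            (suc _)             = []
  vectors (geom₂ ∷ ks)  (suc (suc n))       = map (0 ∷_) (vectors ks (2 + n)) ++ map bump (vectors (geom₂ ∷ ks) n)
  vectors (geom₂ ∷ ks)  n                   = map (0 ∷_) (vectors ks n)
  vectors (geom₃ ∷ ks)  (suc (suc (suc n))) = map (0 ∷_) (vectors ks (3 + n)) ++ map bump (vectors (geom₃ ∷ ks) n)
  vectors (geom₃ ∷ ks)  n                   = map (0 ∷_) (vectors ks n)
  vectors (dec s ∷ ks)  (suc (suc n))       =
    map (0 ∷_) (vectors ks (2 + n)) ++ map (1 ∷_) (vectors ks (1 + n)) ++ map bump₂ (vectors (dec s ∷ ks) n)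
  vectors (dec s ∷ ks)  (suc zero)          = map (0 ∷_) (vectors ks 1) ++ map (1 ∷_) (vectors ks 0)
  vectors (dec s ∷ ks)  zero                = map (0 ∷_) (vectors ks 0)

  private
    deg-cons : ∀ k ks c n {e} → (∀ {e′} → e′ ∈ vectors ks n → deg ks e′ ≡ n) →
               e ∈ map (c ∷_) (vectors ks n) → deg (k ∷ ks) e ≡ degree k c + n
    deg-cons k ks c n sound e∈ with _ , e′∈ , refl ← ∈-map⁻ (c ∷_) e∈ = cong (degree k c +_) (sound e′∈)

    deg-bump : ∀ k ks s n {e} → (∀ a → degree k (suc a) ≡ s + degree k a) →
               (∀ {e′} → e′ ∈ vectors (k ∷ ks) n → deg (k ∷ ks) e′ ≡ n) →
               e ∈ map bump (vectors (k ∷ ks) n) → deg (k ∷ ks) e ≡ s + n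
    deg-bump k ks s n step sound e∈ with a ∷ e′ , e′∈ , refl ← ∈-map⁻ bump e∈ =
      trans (cong (_+ deg ks e′) (step a)) (trans (+-assoc s _ _) (cong (s +_) (sound e′∈)))

    deg-bump₂ : ∀ k ks n {e} → (∀ a → degree k (2 + a) ≡ 2 + degree k a) →
                (∀ {e′} → e′ ∈ vectors (k ∷ ks) n → deg (k ∷ ks) e′ ≡ n) →
                e ∈ map bump₂ (vectors (k ∷ ks) n) → deg (k ∷ ks) e ≡ 2 + n
    deg-bump₂ k ks n step sound e∈ with a ∷ e′ , e′∈ , refl ← ∈-map⁻ bump₂ e∈ =
      trans (cong (_+ deg ks e′) (step a)) (cong (2 +_) (sound e′∈))

  vectors-sound : ∀ ks n {e} → e ∈ vectors ks n → deg ks e ≡ n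
  vectors-sound []           zero                (here refl) = refl
  vectors-sound (geom₂ ∷ ks) (suc (suc n))       e∈ =
    [ deg-cons geom₂ ks 0 _ (vectors-sound ks _)
    , deg-bump geom₂ ks 2 n (*-suc 2) (vectors-sound (geom₂ ∷ ks) n)
    ]′ (∈-++⁻ (map (0 ∷_) (vectors ks (2 + n))) e∈)
  vectors-sound (geom₂ ∷ ks) zero                e∈ = deg-cons geom₂ ks 0 _ (vectors-sound ks _) e∈
  vectors-sound (geom₂ ∷ ks) (suc zero)          e∈ = deg-cons geom₂ ks 0 _ (vectors-sound ks _) e∈
  vectors-sound (geom₃ ∷ ks) (suc (suc (suc n))) e∈ =
    [ deg-cons geom₃ ks 0 _ (vectors-sound ks _)
    , deg-bump geom₃ ks 3 n (*-suc 3) (vectors-sound (geom₃ ∷ ks) n)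
    ]′ (∈-++⁻ (map (0 ∷_) (vectors ks (3 + n))) e∈)
  vectors-sound (geom₃ ∷ ks) zero                e∈ = deg-cons geom₃ ks 0 _ (vectors-sound ks _) e∈
  vectors-sound (geom₃ ∷ ks) (suc zero)          e∈ = deg-cons geom₃ ks 0 _ (vectors-sound ks _) e∈
  vectors-sound (geom₃ ∷ ks) (suc (suc zero))    e∈ = deg-cons geom₃ ks 0 _ (vectors-sound ks _) e∈
  vectors-sound (dec s ∷ ks) (suc (suc n))       e∈ =
    [ deg-cons (dec s) ks 0 _ (vectors-sound ks _)
    , [ deg-cons (dec s) ks 1 _ (vectors-sound ks _)
      , deg-bump₂ (dec s) ks n (λ _ → refl) (vectors-sound (dec s ∷ ks) n)
      ]′ ∘ ∈-++⁻ (map (1 ∷_) (vectors ks (1 + n)))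
    ]′ (∈-++⁻ (map (0 ∷_) (vectors ks (2 + n))) e∈)
  vectors-sound (dec s ∷ ks) (suc zero)          e∈ =
    [ deg-cons (dec s) ks 0 _ (vectors-sound ks _) , deg-cons (dec s) ks 1 _ (vectors-sound ks _) ]′
      (∈-++⁻ (map (0 ∷_) (vectors ks 1)) e∈)
  vectors-sound (dec s ∷ ks) zero                e∈ = deg-cons (dec s) ks 0 _ (vectors-sound ks _) e∈

  private
    zero∈ : ∀ k ks n {e} → e ∈ vectors ks n → (0 ∷ e) ∈ vectors (k ∷ ks) n
    zero∈ geom₂   ks (suc (suc n))       e∈ = ∈-++⁺ˡ (∈-map⁺ (0 ∷_) e∈)
    zero∈ geom₂   ks zero                e∈ = ∈-map⁺ (0 ∷_) e∈
    zero∈ geom₂   ks (suc zero)          e∈ = ∈-map⁺ (0 ∷_) e∈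
    zero∈ geom₃   ks (suc (suc (suc n))) e∈ = ∈-++⁺ˡ (∈-map⁺ (0 ∷_) e∈)
    zero∈ geom₃   ks zero                e∈ = ∈-map⁺ (0 ∷_) e∈
    zero∈ geom₃   ks (suc zero)          e∈ = ∈-map⁺ (0 ∷_) e∈
    zero∈ geom₃   ks (suc (suc zero))    e∈ = ∈-map⁺ (0 ∷_) e∈
    zero∈ (dec s) ks (suc (suc n))       e∈ = ∈-++⁺ˡ (∈-map⁺ (0 ∷_) e∈)
    zero∈ (dec s) ks (suc zero)          e∈ = ∈-++⁺ˡ (∈-map⁺ (0 ∷_) e∈)
    zero∈ (dec s) ks zero                e∈ = ∈-map⁺ (0 ∷_) e∈

    one∈ : ∀ s ks n {e} → e ∈ vectors ks n → (1 ∷ e) ∈ vectors (dec s ∷ ks) (suc n)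
    one∈ s ks zero    e∈ = ∈-++⁺ʳ (map (0 ∷_) (vectors ks 1)) (∈-map⁺ (1 ∷_) e∈)
    one∈ s ks (suc n) e∈ = ∈-++⁺ʳ (map (0 ∷_) (vectors ks (2 + n))) (∈-++⁺ˡ (∈-map⁺ (1 ∷_) e∈))

  vectors-complete : ∀ ks e → e ∈ vectors ks (deg ks e)
  vectors-complete []           []                = here refl
  vectors-complete (geom₂ ∷ ks) (zero ∷ e)        = zero∈ geom₂ ks _ (vectors-complete ks e)
  vectors-complete (geom₃ ∷ ks) (zero ∷ e)        = zero∈ geom₃ ks _ (vectors-complete ks e)
  vectors-complete (dec s ∷ ks) (zero ∷ e)        = zero∈ (dec s) ks _ (vectors-complete ks e)
  vectors-complete (geom₂ ∷ ks) (suc a ∷ e)       =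
    subst (λ n → suc a ∷ e ∈ vectors (geom₂ ∷ ks) n) (sym (step (deg ks e)))
      (∈-++⁺ʳ (map (0 ∷_) (vectors ks _)) (∈-map⁺ bump (vectors-complete (geom₂ ∷ ks) (a ∷ e))))
    where
    step : ∀ d → 2 * suc a + d ≡ 2 + (2 * a + d)
    step d = trans (cong (_+ d) (*-suc 2 a)) (+-assoc 2 (2 * a) d)
  vectors-complete (geom₃ ∷ ks) (suc a ∷ e)       =
    subst (λ n → suc a ∷ e ∈ vectors (geom₃ ∷ ks) n) (sym (step (deg ks e)))
      (∈-++⁺ʳ (map (0 ∷_) (vectors ks _)) (∈-map⁺ bump (vectors-complete (geom₃ ∷ ks) (a ∷ e))))
    where
    step : ∀ d → 3 * suc a + d ≡ 3 + (3 * a + d)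
    step d = trans (cong (_+ d) (*-suc 3 a)) (+-assoc 3 (3 * a) d)
  vectors-complete (dec s ∷ ks) (suc zero ∷ e)    = one∈ s ks _ (vectors-complete ks e)
  vectors-complete (dec s ∷ ks) (suc (suc a) ∷ e) =
    ∈-++⁺ʳ (map (0 ∷_) (vectors ks _)) (∈-++⁺ʳ (map (1 ∷_) (vectors ks _))
      (∈-map⁺ bump₂ (vectors-complete (dec s ∷ ks) (a ∷ e))))

  private
    heads-differ : ∀ {r c} (L : List (Vec ℕ r)) {M : List (Vec ℕ (suc r))} →
                   (∀ {e} → e ∈ M → Data.Vec.head e ≢ c) → Disjoint (map (c ∷_) L) M
    heads-differ L head≢ (e∈L , e∈M) with _ , _ , refl ← ∈-map⁻ _ e∈L = head≢ e∈M refl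

    bumped : ∀ {r} {M : List (Vec ℕ (suc r))} {e} → e ∈ map bump M → ∃ λ a → Data.Vec.head e ≡ suc a
    bumped e∈ with a ∷ _ , _ , refl ← ∈-map⁻ bump e∈ = a , refl

    bumped₂ : ∀ {r} {M : List (Vec ℕ (suc r))} {e} → e ∈ map bump₂ M → ∃ λ a → Data.Vec.head e ≡ 2 + a
    bumped₂ e∈ with a ∷ _ , _ , refl ← ∈-map⁻ bump₂ e∈ = a , refl

    cons-unique : ∀ {r} c {L : List (Vec ℕ r)} → Unique L → Unique (map (c ∷_) L)
    cons-unique c = Unique.map⁺ (λ { refl → refl })

    bump-unique : ∀ {r} {L : List (Vec ℕ (suc r))} → Unique L → Unique (map bump L)
    bump-unique = Unique.map⁺ (λ { {_ ∷ _} {_ ∷ _} refl → refl })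

    bump₂-unique : ∀ {r} {L : List (Vec ℕ (suc r))} → Unique L → Unique (map bump₂ L)
    bump₂-unique = Unique.map⁺ (λ { {_ ∷ _} {_ ∷ _} refl → refl })

    geom-unique : ∀ {r} {L : List (Vec ℕ r)} {M : List (Vec ℕ (suc r))} → Unique L → Unique M →
                  Unique (map (0 ∷_) L ++ map bump M)
    geom-unique {L = L} uL uM =
      Unique.++⁺ (cons-unique 0 uL) (bump-unique uM)
        (heads-differ L λ e∈ head≡0 → 0≢1+n (trans (sym head≡0) (proj₂ (bumped e∈))))

    consed : ∀ {r c} {L : List (Vec ℕ r)} {e} → e ∈ map (c ∷_) L → Data.Vec.head e ≡ c
    consed e∈ with _ , _ , refl ← ∈-map⁻ _ e∈ = refl

    one-unique : ∀ {r} {L₀ L₁ : List (Vec ℕ r)} → Unique L₀ → Unique L₁ →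
                 Unique (map (0 ∷_) L₀ ++ map (1 ∷_) L₁)
    one-unique {L₀ = L₀} u₀ u₁ = Unique.++⁺ (cons-unique 0 u₀) (cons-unique 1 u₁)
      (heads-differ L₀ λ e∈ head≡0 → 1+n≢0 (trans (sym (consed e∈)) head≡0))

    dec-unique : ∀ {r} {L₀ L₁ : List (Vec ℕ r)} {M} → Unique L₀ → Unique L₁ → Unique M →
                 Unique (map (0 ∷_) L₀ ++ map (1 ∷_) L₁ ++ map bump₂ M)
    dec-unique {L₀ = L₀} {L₁} u₀ u₁ uM = Unique.++⁺ (cons-unique 0 u₀)
      (Unique.++⁺ (cons-unique 1 u₁) (bump₂-unique uM)
        (heads-differ L₁ λ e∈ head≡1 → 1+n≢0 (suc-injective (trans (sym (proj₂ (bumped₂ e∈))) head≡1))))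
      (heads-differ L₀ λ e∈ head≡0 → [ (λ e∈₁ → 1+n≢0 (trans (sym (consed e∈₁)) head≡0))
                                       , (λ e∈₂ → 1+n≢0 (trans (sym (proj₂ (bumped₂ e∈₂))) head≡0)) ]′
                                       (∈-++⁻ (map (1 ∷_) L₁) e∈))

  vectors-unique : ∀ ks n → Unique (vectors ks n)
  vectors-unique []           zero                = All.[] ∷ []
  vectors-unique []           (suc n)             = []
  vectors-unique (geom₂ ∷ ks) (suc (suc n))       = geom-unique (vectors-unique ks _) (vectors-unique (geom₂ ∷ ks) n)
  vectors-unique (geom₂ ∷ ks) zero                = cons-unique 0 (vectors-unique ks _)
  vectors-unique (geom₂ ∷ ks) (suc zero)          = cons-unique 0 (vectors-unique ks _)
  vectors-unique (geom₃ ∷ ks) (suc (suc (suc n))) = geom-unique (vectors-unique ks _) (vectors-unique (geom₃ ∷ ks) n)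
  vectors-unique (geom₃ ∷ ks) zero                = cons-unique 0 (vectors-unique ks _)
  vectors-unique (geom₃ ∷ ks) (suc zero)          = cons-unique 0 (vectors-unique ks _)
  vectors-unique (geom₃ ∷ ks) (suc (suc zero))    = cons-unique 0 (vectors-unique ks _)
  vectors-unique (dec s ∷ ks) (suc (suc n))       =
    dec-unique (vectors-unique ks _) (vectors-unique ks _) (vectors-unique (dec s ∷ ks) n)
  vectors-unique (dec s ∷ ks) (suc zero)          = one-unique (vectors-unique ks _) (vectors-unique ks _)
  vectors-unique (dec s ∷ ks) zero                = cons-unique 0 (vectors-unique ks _)

  -- The seven regions of valid triples (i , j , k), j and k positive unless the word is n ⋯ 1:
  -- i = 0; 1 ≤ i ≤ j , k; j < i ≤ k; k < i ≤ j; j , k < i ≤ j + k; j + k < i.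
  data Class : Set where
    reversal noTail iSmall jSmall kSmall iMedium iLarge : Class

  allClasses : List Class
  allClasses = reversal ∷ noTail ∷ iSmall ∷ jSmall ∷ kSmall ∷ iMedium ∷ iLarge ∷ []

  kinds : Class → List Kind
  kinds reversal = dec 0 ∷ []
  kinds noTail   = dec 1 ∷ dec 1 ∷ []
  kinds iSmall   = dec 0 ∷ dec 0 ∷ geom₃ ∷ []
  kinds jSmall   = geom₂ ∷ dec 0 ∷ geom₃ ∷ []
  kinds kSmall   = geom₂ ∷ dec 0 ∷ geom₃ ∷ []
  kinds iMedium  = geom₂ ∷ geom₂ ∷ geom₃ ∷ []
  kinds iLarge   = geom₂ ∷ geom₂ ∷ dec 1 ∷ []

  offset : Class → ℕ
  offset reversal = 0
  offset noTail   = 2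
  offset iSmall   = 3
  offset jSmall   = 5
  offset kSmall   = 5
  offset iMedium  = 4
  offset iLarge   = 5

  -- The power of q common to the weights of all words of a class.
  qPower : Class → ℕ
  qPower reversal = 0
  qPower noTail   = 0
  qPower iSmall   = 2
  qPower jSmall   = 3
  qPower kSmall   = 3
  qPower iMedium  = 2
  qPower iLarge   = 2

  -- Written in the shape that the substitutions in region produce, so that region closes by refl.
  triple : ∀ c → Exponents (kinds c) → Triple
  triple reversal (a ∷ [])         = 0 , 0 , a
  triple noTail   (a ∷ b ∷ [])     = 0 , suc a , suc b
  triple iSmall   (a ∷ b ∷ w ∷ []) = suc w , suc (w + a) , suc (w + b)
  triple jSmall   (c ∷ b ∷ w ∷ []) = suc (suc w + c) , suc w , suc (suc w + c + b)
  triple kSmall   (c ∷ b ∷ w ∷ []) = suc (suc w + c) , suc (suc w + c + b) , suc w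
  triple iMedium  (u ∷ v ∷ w ∷ []) = suc (suc (w + v) + u) , suc (u + w) , suc (w + v)
  triple iLarge   (u ∷ v ∷ a ∷ []) = suc (suc u + suc v + a) , suc u , suc v

  sum3 : Triple → ℕ
  sum3 (i , j , k) = i + j + k

  triple-sum : ∀ c e → sum3 (triple c e) ≡ offset c + deg (kinds c) e
  triple-sum reversal (a ∷ [])         = sym (+-identityʳ a)
  triple-sum noTail   (a ∷ b ∷ [])     = arithmetic a b
    where arithmetic : ∀ a b → 0 + suc a + suc b ≡ 2 + (a + (b + 0))
          arithmetic = solve-∀
  triple-sum iSmall   (a ∷ b ∷ w ∷ []) = arithmetic a b w
    where arithmetic : ∀ a b w → suc w + suc (w + a) + suc (w + b) ≡ 3 + (a + (b + (3 * w + 0)))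
          arithmetic = solve-∀
  triple-sum jSmall   (c ∷ b ∷ w ∷ []) = arithmetic c b w
    where arithmetic : ∀ c b w → suc (suc w + c) + suc w + suc (suc w + c + b) ≡ 5 + (2 * c + (b + (3 * w + 0)))
          arithmetic = solve-∀
  triple-sum kSmall   (c ∷ b ∷ w ∷ []) = arithmetic c b w
    where arithmetic : ∀ c b w → suc (suc w + c) + suc (suc w + c + b) + suc w ≡ 5 + (2 * c + (b + (3 * w + 0)))
          arithmetic = solve-∀
  triple-sum iMedium  (u ∷ v ∷ w ∷ []) = arithmetic u v w
    where arithmetic : ∀ u v w → suc (suc (w + v) + u) + suc (u + w) + suc (w + v) ≡ 4 + (2 * u + (2 * v + (3 * w + 0)))
          arithmetic = solve-∀
  triple-sum iLarge   (u ∷ v ∷ a ∷ []) = arithmetic u v a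
    where arithmetic : ∀ u v a → suc (suc u + suc v + a) + suc u + suc v ≡ 5 + (2 * u + (2 * v + (a + 0)))
          arithmetic = solve-∀

  triple-valid : ∀ c e → Valid (offset c + deg (kinds c) e) (triple c e)
  triple-valid reversal (a ∷ [])         = subst (λ n → Valid n (0 , 0 , a)) (sym (+-identityʳ a)) descending
  triple-valid noTail   e@(_ ∷ _ ∷ [])     = threeBlocks (triple-sum noTail e)
  triple-valid iSmall   e@(_ ∷ _ ∷ _ ∷ []) = threeBlocks (triple-sum iSmall e)
  triple-valid jSmall   e@(_ ∷ _ ∷ _ ∷ []) = threeBlocks (triple-sum jSmall e)
  triple-valid kSmall   e@(_ ∷ _ ∷ _ ∷ []) = threeBlocks (triple-sum kSmall e)
  triple-valid iMedium  e@(_ ∷ _ ∷ _ ∷ []) = threeBlocks (triple-sum iMedium e)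
  triple-valid iLarge   e@(_ ∷ _ ∷ _ ∷ []) = threeBlocks (triple-sum iLarge e)

  private
    u≤j : ∀ k u j → suc (suc k + u) ≤ suc j + suc k → u ≤ j
    u≤j k u j le = +-cancelˡ-≤ k u j (subst (k + u ≤_) (+-comm j k)
      (≤-pred (subst (suc (k + u) ≤_) (+-suc j k) (≤-pred le))))

    w≤k : ∀ u w k → suc (u + w) ≤ suc k + u → w ≤ k
    w≤k u w k le = +-cancelˡ-≤ u w k (subst (u + w ≤_) (+-comm k u) (≤-pred le))

  region : ∀ i j k → ∃₂ λ c e → triple c e ≡ (i , suc j , suc k)
  region zero     j k = noTail , j ∷ k ∷ [] , refl
  region (suc i′) j k with i′ ≤? j | i′ ≤? k
  ... | yes i′≤j | yes i′≤k
    with a , refl ← m≤n⇒∃[o]m+o≡n i′≤j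
    with b , refl ← m≤n⇒∃[o]m+o≡n i′≤k = iSmall , a ∷ b ∷ i′ ∷ [] , refl
  ... | no  i′≰j | yes i′≤k
    with c , refl ← m≤n⇒∃[o]m+o≡n (≰⇒> i′≰j)
    with b , refl ← m≤n⇒∃[o]m+o≡n i′≤k = jSmall , c ∷ b ∷ j ∷ [] , refl
  ... | yes i′≤j | no  i′≰k
    with c , refl ← m≤n⇒∃[o]m+o≡n (≰⇒> i′≰k)
    with b , refl ← m≤n⇒∃[o]m+o≡n i′≤j = kSmall , c ∷ b ∷ k ∷ [] , refl
  ... | no  i′≰j | no  i′≰k with suc i′ ≤? suc j + suc k
  ...   | no  i≰j+k
    with a , refl ← m≤n⇒∃[o]m+o≡n (≤-pred (≰⇒> i≰j+k)) = iLarge , j ∷ k ∷ a ∷ [] , refl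
  ...   | yes i≤j+k
    with u , refl ← m≤n⇒∃[o]m+o≡n (≰⇒> i′≰k)
    with w , refl ← m≤n⇒∃[o]m+o≡n (u≤j k u j i≤j+k)
    with v , refl ← m≤n⇒∃[o]m+o≡n (w≤k u w k (≰⇒> i′≰j)) = iMedium , u ∷ v ∷ w ∷ [] , refl

  classify : ∀ {n t} → Valid n t → ∃₂ λ c e → triple c e ≡ t × offset c + deg (kinds c) e ≡ n
  classify {n} descending = reversal , n ∷ [] , refl , +-identityʳ n
  classify v@(threeBlocks {i} {j} {k} _) with c , e , t≡ ← region i j k =
    c , e , t≡ , trans (sym (triple-sum c e)) (trans (cong sum3 t≡) (valid-sum v))

  classOf : Triple → Class
  classOf (i , j , k) =
    if j ≡ᵇ 0 then reversal
    else if i ≡ᵇ 0 then noTail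
    else if i ≤ᵇ j then (if i ≤ᵇ k then iSmall else kSmall)
    else if i ≤ᵇ k then jSmall
    else if i ≤ᵇ j + k then iMedium
    else iLarge

  private
    ≤ᵇ-true : ∀ {m n} → m ≤ n → (m ≤ᵇ n) ≡ true
    ≤ᵇ-true m≤n = to T-≡ (≤⇒≤ᵇ m≤n)

    ≤ᵇ-false : ∀ {m n} → n < m → (m ≤ᵇ n) ≡ false
    ≤ᵇ-false {m} {n} n<m with m ≤ᵇ n in eq
    ... | false = refl
    ... | true  = ⊥-elim (<⇒≱ n<m (≤ᵇ⇒≤ m n (from T-≡ eq)))

  classOf-triple : ∀ c e → classOf (triple c e) ≡ c
  classOf-triple reversal (a ∷ [])         = refl
  classOf-triple noTail   (a ∷ b ∷ [])     = refl
  classOf-triple iSmall   (a ∷ b ∷ w ∷ [])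
    rewrite ≤ᵇ-true (s≤s (m≤m+n w a)) | ≤ᵇ-true (s≤s (m≤m+n w b)) = refl
  classOf-triple jSmall   (c ∷ b ∷ w ∷ [])
    rewrite ≤ᵇ-false (s≤s (s≤s (m≤m+n w c))) | ≤ᵇ-true (s≤s (m≤m+n (suc w + c) b)) = refl
  classOf-triple kSmall   (c ∷ b ∷ w ∷ [])
    rewrite ≤ᵇ-true (s≤s (m≤m+n (suc w + c) b)) | ≤ᵇ-false (s≤s (s≤s (m≤m+n w c))) = refl
  classOf-triple iMedium  (u ∷ v ∷ w ∷ [])
    rewrite ≤ᵇ-false {suc (suc (w + v) + u)} {suc (u + w)}
              (s≤s (s≤s (≤-trans (≤-reflexive (+-comm u w)) (+-monoˡ-≤ u (m≤m+n w v)))))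
          | ≤ᵇ-false {suc (suc (w + v) + u)} {suc (w + v)} (s≤s (s≤s (m≤m+n (w + v) u)))
          | ≤ᵇ-true {suc (suc (w + v) + u)} {suc (u + w) + suc (w + v)}
              (s≤s (≤-trans (+-monoʳ-≤ (suc (w + v)) (m≤m+n u w)) (≤-reflexive (+-comm (suc (w + v)) (u + w))))) = refl
  classOf-triple iLarge   (u ∷ v ∷ a ∷ [])
    rewrite ≤ᵇ-false {suc (suc u + suc v + a)} {suc u} (s≤s (≤-trans (m≤m+n (suc u) (suc v)) (m≤m+n _ a)))
          | ≤ᵇ-false {suc (suc u + suc v + a)} {suc v} (s≤s (≤-trans (m≤n+m (suc v) (suc u)) (m≤m+n _ a)))
          | ≤ᵇ-false {suc (suc u + suc v + a)} {suc u + suc v} (s≤s (m≤m+n (suc u + suc v) a)) = refl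

  private
    ≡-components : ∀ {i j k i′ j′ k′ : ℕ} → (i , j , k) ≡ (i′ , j′ , k′) → i ≡ i′ × j ≡ j′ × k ≡ k′
    ≡-components refl = refl , refl , refl

  triple-injective : ∀ c {e e′} → triple c e ≡ triple c e′ → e ≡ e′
  triple-injective reversal {_ ∷ []} {_ ∷ []} eq
    with _ , _ , refl ← ≡-components eq = refl
  triple-injective noTail {_ ∷ _ ∷ []} {_ ∷ _ ∷ []} eq
    with _ , refl , refl ← ≡-components eq = refl
  triple-injective iSmall {a ∷ b ∷ w ∷ []} {_ ∷ _ ∷ _ ∷ []} eq
    with refl , j≡ , k≡ ← ≡-components eq
    with refl ← +-cancelˡ-≡ w _ _ (suc-injective j≡)
    with refl ← +-cancelˡ-≡ w _ _ (suc-injective k≡) = refl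
  triple-injective jSmall {c ∷ b ∷ w ∷ []} {_ ∷ _ ∷ _ ∷ []} eq
    with i≡ , refl , k≡ ← ≡-components eq
    with refl ← +-cancelˡ-≡ (suc w) _ _ (suc-injective i≡)
    with refl ← +-cancelˡ-≡ (suc w + c) _ _ (suc-injective k≡) = refl
  triple-injective kSmall {c ∷ b ∷ w ∷ []} {_ ∷ _ ∷ _ ∷ []} eq
    with i≡ , j≡ , refl ← ≡-components eq
    with refl ← +-cancelˡ-≡ (suc w) _ _ (suc-injective i≡)
    with refl ← +-cancelˡ-≡ (suc w + c) _ _ (suc-injective j≡) = refl
  triple-injective iMedium {u ∷ v ∷ w ∷ []} {u′ ∷ v′ ∷ w′ ∷ []} eq
    with i≡ , j≡ , k≡ ← ≡-components eq
    with refl ← +-cancelˡ-≡ (w + v) u u′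
                  (trans (suc-injective (suc-injective i≡)) (cong (_+ u′) (sym (suc-injective k≡))))
    with refl ← +-cancelˡ-≡ u w w′ (suc-injective j≡)
    with refl ← +-cancelˡ-≡ w v v′ (suc-injective k≡) = refl
  triple-injective iLarge {u ∷ v ∷ a ∷ []} {_ ∷ _ ∷ _ ∷ []} eq
    with i≡ , refl , refl ← ≡-components eq
    with refl ← +-cancelˡ-≡ (suc u + suc v) _ _ (suc-injective i≡) = refl

  delayed : ∀ {A : Set} → ℕ → (ℕ → List A) → ℕ → List A
  delayed zero    f n       = f n
  delayed (suc d) f zero    = []
  delayed (suc d) f (suc n) = delayed d f n

  module _ {A : Set} {f : ℕ → List A} where

    ∈-delayed⁺ : ∀ d {m n x} → d + m ≡ n → x ∈ f m → x ∈ delayed d f n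
    ∈-delayed⁺ zero    refl x∈ = x∈
    ∈-delayed⁺ (suc d) refl x∈ = ∈-delayed⁺ d refl x∈

    ∈-delayed⁻ : ∀ d n {x} → x ∈ delayed d f n → ∃ λ m → d + m ≡ n × x ∈ f m
    ∈-delayed⁻ zero    n       x∈ = n , refl , x∈
    ∈-delayed⁻ (suc d) (suc n) x∈ with m , refl , x∈′ ← ∈-delayed⁻ d n x∈ = m , refl , x∈′

    delayed-unique : (∀ m → Unique (f m)) → ∀ d n → Unique (delayed d f n)
    delayed-unique unique zero    n       = unique n
    delayed-unique unique (suc d) zero    = []
    delayed-unique unique (suc d) (suc n) = delayed-unique unique d n

  classVectors : ∀ c → ℕ → List (Exponents (kinds c))
  classVectors c = delayed (offset c) (vectors (kinds c))

  classTriples : ℕ → List Triple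
  classTriples n = concatMap (λ c → map (triple c) (classVectors c n)) allClasses

  private
    allClasses-unique : Unique allClasses
    allClasses-unique =
        ((λ ()) All.∷ (λ ()) All.∷ (λ ()) All.∷ (λ ()) All.∷ (λ ()) All.∷ (λ ()) All.∷ All.[])
      ∷ ((λ ()) All.∷ (λ ()) All.∷ (λ ()) All.∷ (λ ()) All.∷ (λ ()) All.∷ All.[])
      ∷ ((λ ()) All.∷ (λ ()) All.∷ (λ ()) All.∷ (λ ()) All.∷ All.[])
      ∷ ((λ ()) All.∷ (λ ()) All.∷ (λ ()) All.∷ All.[])
      ∷ ((λ ()) All.∷ (λ ()) All.∷ All.[])
      ∷ ((λ ()) All.∷ All.[])
      ∷ All.[] ∷ []

    ∈-allClasses : ∀ c → c ∈ allClasses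
    ∈-allClasses reversal = here refl
    ∈-allClasses noTail   = there (here refl)
    ∈-allClasses iSmall   = there (there (here refl))
    ∈-allClasses jSmall   = there (there (there (here refl)))
    ∈-allClasses kSmall   = there (there (there (there (here refl))))
    ∈-allClasses iMedium  = there (there (there (there (there (here refl)))))
    ∈-allClasses iLarge   = there (there (there (there (there (there (here refl))))))

  classTriples-unique : ∀ n → Unique (classTriples n)
  classTriples-unique n = concatMap-unique _ classOf allClasses-unique
    (λ c → Unique.map⁺ (triple-injective c) (delayed-unique (vectors-unique (kinds c)) (offset c) n))
    (λ c t∈ → let _ , _ , t≡ = ∈-map⁻ (triple c) t∈ in trans (cong classOf t≡) (classOf-triple c _))

  valid⇒∈classTriples : ∀ {n t} → Valid n t → t ∈ classTriples n
  valid⇒∈classTriples v with c , e , refl , deg≡ ← classify v =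
    ∈-concatMap⁺ (λ c → map (triple c) (classVectors c _))
      (lose (∈-allClasses c) (∈-map⁺ (triple c)
        (∈-delayed⁺ {f = vectors (kinds c)} (offset c) deg≡ (vectors-complete (kinds c) e))))

  ∈classTriples⇒valid : ∀ {n t} → t ∈ classTriples n → Valid n t
  ∈classTriples⇒valid {n} t∈
    with c , _ , t∈c ← find (∈-concatMap⁻ (λ c → map (triple c) (classVectors c n)) {xs = allClasses} t∈)
    with e , e∈ , refl ← ∈-map⁻ (triple c) t∈c
    with m , refl , e∈m ← ∈-delayed⁻ {f = vectors (kinds c)} (offset c) n e∈ =
    subst (λ m → Valid (offset c + m) (triple c e)) (vectors-sound (kinds c) m e∈m) (triple-valid c e)

module Counting where

  open import Data.Nat using (ℕ; zero; suc; _+_; _∸_; _<_; _≡ᵇ_; z≤n; s≤s)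
  open import Data.Nat.Properties
  open import Data.Bool using (true; false; if_then_else_)
  open import Data.Bool.Properties using (T-≡)
  open import Data.List using (List; []; _∷_; _++_; map; length)
  open import Data.List.Membership.Propositional using (_∈_; _∉_)
  open import Data.List.Membership.Propositional.Properties
  open import Data.List.Relation.Unary.Any using (here; there)
  open import Data.List.Relation.Unary.All as All using (All)
  open import Data.List.Relation.Unary.Unique.Propositional using (Unique; []; _∷_)
  import Data.List.Relation.Unary.Unique.Propositional.Properties as Unique
  open import Data.List.Relation.Binary.Permutation.Propositional using (_↭_)
  open import Data.List.Relation.Binary.BagAndSetEquality using (∼bag⇒↭)
  open import Data.List.Membership.Propositional.Properties.WithK using (unique∧set⇒bag)
  open import Data.Product using (_,_; proj₁; proj₂)
  open import Data.Empty using (⊥-elim)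
  open import Function using (_∘_; mk⇔; Equivalence)
  open import Relation.Binary.PropositionalEquality
  open import Defs
  open Avoidance
  open Blocks
  open Classes using (classTriples; classTriples-unique; valid⇒∈classTriples; ∈classTriples⇒valid)
  open Lists using (concatMap-unique; unique-map)

  open Equivalence using (to; from)

  private
    first : List ℕ → ℕ
    first []      = 0
    first (a ∷ _) = a

    indexOf : ℕ → List ℕ → ℕ
    indexOf a []      = 0
    indexOf a (b ∷ w) = if a ≡ᵇ b then 0 else suc (indexOf a w)

    indexOf-++ : ∀ {a b} xs {ys} → a ∉ xs → a ≡ b → indexOf a (xs ++ b ∷ ys) ≡ length xs
    indexOf-++ {a} []       _  refl rewrite to T-≡ (≡⇒≡ᵇ a a refl) = refl
    indexOf-++ {a} (x ∷ xs) a∉ a≡b with a ≡ᵇ x in eq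
    ... | true  = ⊥-elim (a∉ (here (≡ᵇ⇒≡ a x (from T-≡ eq))))
    ... | false = cong suc (indexOf-++ xs (a∉ ∘ there) a≡b)

    decode : ℕ → ℕ → ℕ → Triple
    decode n zero    h = 0 , 0 , n
    decode n (suc p) h = h ∸ suc p , suc p , n ∸ h

  -- The maximum n sits at position j of a block word, whose first letter is i + j.
  unblocks : List ℕ → Triple
  unblocks w = decode (length w) (indexOf (length w) w) (first w)

  private
    max∉first : ∀ i j k → i + suc j + suc k ∉ run i (suc j)
    max∉first i j k n∈ = <⇒≱ (m<m+n (i + suc j) (s≤s z≤n)) (proj₂ (∈-run⁻ n∈))

    decode-blocks : ∀ {n t} → Valid n t → decode n (indexOf n (blocks t)) (first (blocks t)) ≡ t
    decode-blocks (threeBlocks {i} {j} {k} refl) =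
      trans (cong (λ p → decode (i + suc j + suc k) p (suc (i + j)))
                  (trans (indexOf-++ (run i (suc j)) (max∉first i j k) (+-suc (i + suc j) k)) (length-run i (suc j))))
            (cong₂ _,_ (m+n∸n≡m i j)
                       (cong (suc j ,_) (trans (cong (λ m → m + suc k ∸ suc (i + j)) (+-suc i j))
                                               (m+n∸m≡n (suc (i + j)) (suc k)))))
    decode-blocks {zero}  descending = refl
    decode-blocks {suc m} descending rewrite to T-≡ (≡⇒≡ᵇ m m refl) = refl

  unblocks-blocks : ∀ {n t} → Valid n t → unblocks (blocks t) ≡ t
  unblocks-blocks {n} {t} v rewrite Avoider.length≡ (blocks-avoider {i = proj₁ t} (valid-sum v)) = decode-blocks v

  words-unique : ∀ {as} → Unique as → ∀ k → Unique (words as k)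
  words-unique uniq zero    = All.[] ∷ []
  words-unique uniq (suc k) = concatMap-unique _ first uniq
    (λ a → Unique.map⁺ (λ { refl → refl }) (words-unique uniq k))
    (λ a w∈ → let _ , _ , w≡ = ∈-map⁻ (a ∷_) w∈ in cong first w≡)

  SymAv-unique : ∀ n → Unique (SymAv Σ₀ n)
  SymAv-unique n = Unique.filter⁺ _ (Unique.filter⁺ _
    (words-unique (range-unique n) n))

  SymAv↭blocks : ∀ n → SymAv Σ₀ n ↭ map blocks (classTriples n)
  SymAv↭blocks n = ∼bag⇒↭ (unique∧set⇒bag (SymAv-unique n)
    (unique-map blocks unblocks (unblocks-blocks ∘ ∈classTriples⇒valid {n}) (classTriples-unique n))
    (mk⇔ into outof))
    where
    into : ∀ {w} → w ∈ SymAv Σ₀ n → w ∈ map blocks (classTriples n)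
    into w∈ with t , v , refl ← avoider⇒blocks (∈-SymAv⁻ n w∈) = ∈-map⁺ blocks (valid⇒∈classTriples v)
    outof : ∀ {w} → w ∈ map blocks (classTriples n) → w ∈ SymAv Σ₀ n
    outof w∈ with t , t∈ , refl ← ∈-map⁻ blocks w∈ =
      ∈-SymAv⁺ n (blocks-avoider {i = proj₁ t} (valid-sum (∈classTriples⇒valid t∈)))

module Series where

  open import Data.Nat using (ℕ; zero; suc; _∸_)
  open import Data.Integer using (ℤ; _+_; _*_; 0ℤ; 1ℤ)
  open import Data.Integer.Properties
    using (+-identityˡ; +-identityʳ; *-identityʳ; *-zeroʳ; *-distribˡ-+; *-distribʳ-+; *-assoc; +-assoc)
  open import Data.Integer.Tactic.RingSolver using (solve-∀)
  open import Data.List using (List; []; _∷_; _++_; map; foldr; upTo; concatMap)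
  open import Data.List.Membership.Propositional using (_∈_)
  open import Data.List.Relation.Unary.Any using (here; there)
  open import Data.List.Properties using (map-applyUpTo; map-upTo)
  open import Data.List.Relation.Binary.Permutation.Propositional using (_↭_; refl; prep; swap; trans)
  open import Function using (_∘_)
  open import Relation.Binary.PropositionalEquality as ≡ using (_≡_; _≗_; cong; cong₂; sym)
  open import Defs

  Seq : Set
  Seq = ℕ → ℤ

  -- The coefficients of P(z) · Σ f(n) zⁿ.
  act : Poly → Seq → Seq
  act []      f _       = 0ℤ
  act (p ∷ P) f zero    = p * f zero
  act (p ∷ P) f (suc n) = p * f (suc n) + act P f n

  shift : Seq → Seq
  shift f zero    = 0ℤ
  shift f (suc n) = f n

  δ : Seq
  δ zero    = 1ℤ
  δ (suc _) = 0ℤ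

  private
    Σ-upTo-suc : ∀ (g : ℕ → ℤ) n →
      foldr _+_ 0ℤ (map g (upTo (suc n))) ≡ g 0 + foldr _+_ 0ℤ (map (g ∘ suc) (upTo n))
    Σ-upTo-suc g n = cong (λ xs → g 0 + foldr _+_ 0ℤ xs)
      (≡.trans (map-applyUpTo suc g n) (sym (map-upTo (g ∘ suc) n)))

  seriesMulCoeff≡act : ∀ P f n → seriesMulCoeff P f n ≡ act P f n
  seriesMulCoeff≡act []      f zero    = ≡.refl
  seriesMulCoeff≡act []      f (suc n) = ≡.trans (Σ-upTo-suc (λ k → coeff [] k * f (suc n ∸ k)) (suc n))
    (≡.trans (+-identityˡ _) (seriesMulCoeff≡act [] f n))
  seriesMulCoeff≡act (p ∷ P) f zero    = +-identityʳ (p * f zero)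
  seriesMulCoeff≡act (p ∷ P) f (suc n) = ≡.trans (Σ-upTo-suc (λ k → coeff (p ∷ P) k * f (suc n ∸ k)) (suc n))
    (cong (λ r → p * f (suc n) + r) (seriesMulCoeff≡act P f n))

  act-zero : ∀ P → act P (λ _ → 0ℤ) ≗ λ _ → 0ℤ
  act-zero []      _       = ≡.refl
  act-zero (p ∷ P) zero    = *-zeroʳ p
  act-zero (p ∷ P) (suc n) = cong₂ _+_ (*-zeroʳ p) (act-zero P n)

  shift-cong : ∀ {f g} → f ≗ g → shift f ≗ shift g
  shift-cong f≗g zero    = ≡.refl
  shift-cong f≗g (suc n) = f≗g n

  act-cong : ∀ P {f g} → f ≗ g → act P f ≗ act P g
  act-cong []      f≗g _       = ≡.refl
  act-cong (p ∷ P) f≗g zero    = cong (p *_) (f≗g zero)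
  act-cong (p ∷ P) f≗g (suc n) = cong₂ (λ a b → p * a + b) (f≗g (suc n)) (act-cong P f≗g n)

  act-∷ : ∀ p P f → act (p ∷ P) f ≗ λ n → p * f n + shift (act P f) n
  act-∷ p P f zero    = sym (+-identityʳ (p * f zero))
  act-∷ p P f (suc n) = ≡.refl

  act-+ : ∀ P f g → act P (λ n → f n + g n) ≗ λ n → act P f n + act P g n
  act-+ []      f g _       = ≡.refl
  act-+ (p ∷ P) f g zero    = *-distribˡ-+ p (f zero) (g zero)
  act-+ (p ∷ P) f g (suc n) =
    ≡.trans (cong (λ r → p * (f (suc n) + g (suc n)) + r) (act-+ P f g n)) (interchange p _ _ _ _)
    where
    interchange : ∀ p a b c d → p * (a + b) + (c + d) ≡ (p * a + c) + (p * b + d)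
    interchange = solve-∀

  act-scale : ∀ P c f → act P (λ n → c * f n) ≗ λ n → c * act P f n
  act-scale []      c f _       = sym (*-zeroʳ c)
  act-scale (p ∷ P) c f zero    = swap-factors p c (f zero)
    where
    swap-factors : ∀ p c a → p * (c * a) ≡ c * (p * a)
    swap-factors = solve-∀
  act-scale (p ∷ P) c f (suc n) =
    ≡.trans (cong (λ r → p * (c * f (suc n)) + r) (act-scale P c f n)) (factor p c _ _)
    where
    factor : ∀ p c a b → p * (c * a) + c * b ≡ c * (p * a + b)
    factor = solve-∀

  act-shift : ∀ P f → act P (shift f) ≗ shift (act P f)
  act-shift []      f zero          = ≡.refl
  act-shift []      f (suc n)       = ≡.refl
  act-shift (p ∷ P) f zero          = *-zeroʳ p
  act-shift (p ∷ P) f (suc n)       =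
    ≡.trans (cong (λ r → p * f n + r) (act-shift P f n)) (sym (act-∷ p P f n))

  act-comm : ∀ P Q f → act P (act Q f) ≗ act Q (act P f)
  act-comm []      Q f n = sym (act-zero Q n)
  act-comm (p ∷ P) Q f n = begin
    act (p ∷ P) (act Q f) n                          ≡⟨ act-∷ p P (act Q f) n ⟩
    p * act Q f n + shift (act P (act Q f)) n        ≡⟨ cong (λ r → p * act Q f n + r) (shift-cong (act-comm P Q f) n) ⟩
    p * act Q f n + shift (act Q (act P f)) n        ≡⟨ cong₂ _+_ (sym (act-scale Q p f n)) (sym (act-shift Q (act P f) n)) ⟩
    act Q (λ m → p * f m) n + act Q (shift (act P f)) n ≡⟨ sym (act-+ Q _ _ n) ⟩
    act Q (λ m → p * f m + shift (act P f) m) n      ≡⟨ act-cong Q (λ m → sym (act-∷ p P f m)) n ⟩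
    act Q (act (p ∷ P) f) n                          ∎
    where open ≡.≡-Reasoning

  act-addP : ∀ P Q f → act (addP P Q) f ≗ λ n → act P f n + act Q f n
  act-addP []      Q       f n       = sym (+-identityˡ _)
  act-addP (p ∷ P) []      f n       = sym (+-identityʳ _)
  act-addP (p ∷ P) (q ∷ Q) f zero    = *-distribʳ-+ (f zero) p q
  act-addP (p ∷ P) (q ∷ Q) f (suc n) =
    ≡.trans (cong (λ r → (p + q) * f (suc n) + r) (act-addP P Q f n)) (interchange p q _ _ _)
    where
    interchange : ∀ p q a b c → (p + q) * a + (b + c) ≡ (p * a + b) + (q * a + c)
    interchange = solve-∀

  act-map* : ∀ c P f → act (map (c *_) P) f ≗ λ n → c * act P f n
  act-map* c []      f _       = sym (*-zeroʳ c)
  act-map* c (p ∷ P) f zero    = *-assoc c p (f zero)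
  act-map* c (p ∷ P) f (suc n) =
    ≡.trans (cong (λ r → c * p * f (suc n) + r) (act-map* c P f n)) (factor c p _ _)
    where
    factor : ∀ c p a b → c * p * a + c * b ≡ c * (p * a + b)
    factor = solve-∀

  act-mulP : ∀ P Q f → act (mulP P Q) f ≗ act P (act Q f)
  act-mulP []      Q f _ = ≡.refl
  act-mulP (p ∷ P) Q f n = begin
    act (addP (map (p *_) Q) (0ℤ ∷ mulP P Q)) f n          ≡⟨ act-addP (map (p *_) Q) _ f n ⟩
    act (map (p *_) Q) f n + act (0ℤ ∷ mulP P Q) f n       ≡⟨ cong₂ _+_ (act-map* p Q f n) (act-∷ 0ℤ (mulP P Q) f n) ⟩
    p * act Q f n + (0ℤ + shift (act (mulP P Q) f) n)     ≡⟨ cong (λ r → p * act Q f n + r)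
                                                               (≡.trans (+-identityˡ _) (shift-cong (act-mulP P Q f) n)) ⟩
    p * act Q f n + shift (act P (act Q f)) n             ≡⟨ sym (act-∷ p P (act Q f) n) ⟩
    act (p ∷ P) (act Q f) n                                ∎
    where open ≡.≡-Reasoning

  act-δ : ∀ P → act P δ ≗ coeff P
  act-δ []      _       = ≡.refl
  act-δ (p ∷ P) zero    = *-identityʳ p
  act-δ (p ∷ P) (suc n) = ≡.trans (cong₂ _+_ (*-zeroʳ p) (act-δ P n)) (+-identityˡ _)

  actAll : List Poly → Seq → Seq
  actAll []       f = f
  actAll (P ∷ Ps) f = act P (actAll Ps f)

  product : List Poly → Poly
  product []       = 1ℤ ∷ []
  product (P ∷ Ps) = mulP P (product Ps)

  actAll-cong : ∀ Ps {f g} → f ≗ g → actAll Ps f ≗ actAll Ps g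
  actAll-cong []       f≗g = f≗g
  actAll-cong (P ∷ Ps) f≗g = act-cong P (actAll-cong Ps f≗g)

  actAll-++ : ∀ Ps Qs f → actAll (Ps ++ Qs) f ≡ actAll Ps (actAll Qs f)
  actAll-++ []       Qs f = ≡.refl
  actAll-++ (P ∷ Ps) Qs f = cong (act P) (actAll-++ Ps Qs f)

  act-actAll : ∀ P Qs f → act P (actAll Qs f) ≗ actAll Qs (act P f)
  act-actAll P []       f = λ _ → ≡.refl
  act-actAll P (Q ∷ Qs) f n = ≡.trans (act-comm P Q (actAll Qs f) n) (act-cong Q (act-actAll P Qs f) n)

  actAll-↭ : ∀ {Ps Qs} f → Ps ↭ Qs → actAll Ps f ≗ actAll Qs f
  actAll-↭ f refl          = λ _ → ≡.refl
  actAll-↭ f (prep P p)    = act-cong P (actAll-↭ f p)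
  actAll-↭ f (swap P Q p) n =
    ≡.trans (act-cong P (act-cong Q (actAll-↭ f p)) n) (act-comm P Q _ n)
  actAll-↭ f (trans p₁ p₂) n = ≡.trans (actAll-↭ f p₁ n) (actAll-↭ f p₂ n)

  actAll-δ : ∀ Ps → actAll Ps δ ≗ coeff (product Ps)
  actAll-δ []       zero    = ≡.refl
  actAll-δ []       (suc n) = ≡.refl
  actAll-δ (P ∷ Ps) n = begin
    act P (actAll Ps δ) n             ≡⟨ act-cong P (λ m → ≡.trans (actAll-δ Ps m) (sym (act-δ (product Ps) m))) n ⟩
    act P (act (product Ps) δ) n      ≡⟨ sym (act-mulP P (product Ps) δ n) ⟩
    act (mulP P (product Ps)) δ n     ≡⟨ act-δ (mulP P (product Ps)) n ⟩
    coeff (mulP P (product Ps)) n     ∎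
    where open ≡.≡-Reasoning

  sumOver : ∀ {A : Set} → (A → ℤ) → List A → ℤ
  sumOver f = foldr (λ a s → f a + s) 0ℤ

  sumOver-++ : ∀ {A : Set} (f : A → ℤ) xs ys → sumOver f (xs ++ ys) ≡ sumOver f xs + sumOver f ys
  sumOver-++ f []       ys = sym (+-identityˡ _)
  sumOver-++ f (x ∷ xs) ys = ≡.trans (cong (λ r → f x + r) (sumOver-++ f xs ys)) (sym (+-assoc (f x) _ _))

  sumOver-map : ∀ {A : Set} {B : Set} (f : B → ℤ) (g : A → B) xs → sumOver f (map g xs) ≡ sumOver (f ∘ g) xs
  sumOver-map f g []       = ≡.refl
  sumOver-map f g (x ∷ xs) = cong (λ r → f (g x) + r) (sumOver-map f g xs)

  sumOver-cong : ∀ {A : Set} {f g : A → ℤ} xs → (∀ {x} → x ∈ xs → f x ≡ g x) → sumOver f xs ≡ sumOver g xs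
  sumOver-cong []       _   = ≡.refl
  sumOver-cong (x ∷ xs) f≡g = cong₂ _+_ (f≡g (here ≡.refl)) (sumOver-cong xs (f≡g ∘ there))

  sumOver-scale : ∀ {A : Set} c (f : A → ℤ) xs → sumOver (λ x → c * f x) xs ≡ c * sumOver f xs
  sumOver-scale c f []       = sym (*-zeroʳ c)
  sumOver-scale c f (x ∷ xs) =
    ≡.trans (cong (λ r → c * f x + r) (sumOver-scale c f xs)) (sym (*-distribˡ-+ c (f x) _))

  sumOver-↭ : ∀ {A : Set} (f : A → ℤ) {xs ys} → xs ↭ ys → sumOver f xs ≡ sumOver f ys
  sumOver-↭ f refl          = ≡.refl
  sumOver-↭ f (prep x p)    = cong (λ r → f x + r) (sumOver-↭ f p)
  sumOver-↭ f (swap x y p)  = ≡.trans (cong (λ r → f x + (f y + r)) (sumOver-↭ f p)) (exchange (f x) (f y) _)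
    where
    exchange : ∀ a b c → a + (b + c) ≡ b + (a + c)
    exchange = solve-∀
  sumOver-↭ f (trans p₁ p₂) = ≡.trans (sumOver-↭ f p₁) (sumOver-↭ f p₂)

  sumOver-concatMap : ∀ {A : Set} {B : Set} (f : B → ℤ) (g : A → List B) xs →
                      sumOver f (concatMap g xs) ≡ sumOver (sumOver f ∘ g) xs
  sumOver-concatMap f g []       = ≡.refl
  sumOver-concatMap f g (x ∷ xs) =
    ≡.trans (sumOver-++ f (g x) (concatMap g xs)) (cong (λ r → sumOver f (g x) + r) (sumOver-concatMap f g xs))

  act-sumOver : ∀ {A : Set} P (g : A → Seq) xs →
                act P (λ n → sumOver (λ a → g a n) xs) ≗ λ n → sumOver (λ a → act P (g a) n) xs
  act-sumOver P g []       = act-zero P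
  act-sumOver P g (x ∷ xs) n =
    ≡.trans (act-+ P (g x) _ n) (cong (λ r → act P (g x) n + r) (act-sumOver P g xs n))

  actAll-sumOver : ∀ {A : Set} Ps (g : A → Seq) xs →
                   actAll Ps (λ n → sumOver (λ a → g a n) xs) ≗ λ n → sumOver (λ a → actAll Ps (g a) n) xs
  actAll-sumOver []       g xs n = ≡.refl
  actAll-sumOver (P ∷ Ps) g xs n =
    ≡.trans (act-cong P (actAll-sumOver Ps g xs) n) (act-sumOver P (λ a → actAll Ps (g a)) xs n)

  coeff-addP : ∀ P Q n → coeff (addP P Q) n ≡ coeff P n + coeff Q n
  coeff-addP []      Q       n       = sym (+-identityˡ _)
  coeff-addP (p ∷ P) []      n       = sym (+-identityʳ _)
  coeff-addP (p ∷ P) (q ∷ Q) zero    = ≡.refl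
  coeff-addP (p ∷ P) (q ∷ Q) (suc n) = coeff-addP P Q n

  coeff-padded : ∀ P n → coeff (P ++ 0ℤ ∷ []) n ≡ coeff P n
  coeff-padded []      zero    = ≡.refl
  coeff-padded []      (suc n) = ≡.refl
  coeff-padded (p ∷ P) zero    = ≡.refl
  coeff-padded (p ∷ P) (suc n) = coeff-padded P n

  monomial : ℕ → ℤ → Poly
  monomial zero    c = c ∷ []
  monomial (suc d) c = 0ℤ ∷ monomial d c

  act-1 : ∀ a f n → act (a ∷ []) f n ≡ a * f n
  act-1 a f zero    = ≡.refl
  act-1 a f (suc n) = +-identityʳ (a * f (suc n))

  act-2 : ∀ a b f n → act (a ∷ b ∷ []) f (suc n) ≡ a * f (suc n) + b * f n
  act-2 a b f n = cong (λ r → a * f (suc n) + r) (act-1 b f n)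

  act-3 : ∀ a b c f n → act (a ∷ b ∷ c ∷ []) f (suc (suc n)) ≡ a * f (suc (suc n)) + (b * f (suc n) + c * f n)
  act-3 a b c f n = cong (λ r → a * f (suc (suc n)) + r) (act-2 b c f n)

  act-4 : ∀ a b c d f n → act (a ∷ b ∷ c ∷ d ∷ []) f (suc (suc (suc n))) ≡
          a * f (suc (suc (suc n))) + (b * f (suc (suc n)) + (c * f (suc n) + d * f n))
  act-4 a b c d f n = cong (λ r → a * f (suc (suc (suc n))) + r) (act-3 b c d f n)

module Weights (x q : ℤ) where

  open import Data.Nat as ℕ using (ℕ; zero; suc; _∸_; _⊓_; _≤_; _<_; _<ᵇ_; _≡ᵇ_; z≤n; s≤s)
  import Data.Nat.Properties as ℕ
  open import Data.Integer using (+_; -_; _+_; _*_; _^_; 1ℤ)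
  open import Data.Integer.Properties using (*-assoc; *-identityʳ; *-identityˡ)
  open import Data.Integer.Tactic.RingSolver using (solve-∀)
  open import Data.Bool using (true; false; if_then_else_)
  open import Data.Bool.Properties using (T-≡)
  open import Data.List using (List; []; _∷_; _++_; length)
  open import Data.Empty using (⊥-elim)
  open import Data.Product using (_,_)
  open import Function using (Equivalence)
  open import Relation.Binary.PropositionalEquality
  open import Defs
  open Avoidance using (<ᵇ-true; <ᵇ-false)
  open Blocks using (run; length-run; blocks)

  open Equivalence using (to; from)

  -- The weight x^fp q^exc of the reversal n ⋯ 1: its middle letter is fixed when n is odd,
  -- and the letters of its first half are the exceedances.
  reversalWeight : ℕ → ℤ
  reversalWeight zero          = 1ℤ
  reversalWeight (suc zero)    = x
  reversalWeight (suc (suc n)) = q * reversalWeight n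

  letterWeight : ℕ → ℕ → ℤ
  letterWeight a p = if a ≡ᵇ p then x else if p <ᵇ a then q else 1ℤ

  weightFrom : ℕ → List ℕ → ℤ
  weightFrom p []      = 1ℤ
  weightFrom p (a ∷ w) = letterWeight a p * weightFrom (suc p) w

  private
    ≡ᵇ-true : ∀ {m n} → m ≡ n → (m ≡ᵇ n) ≡ true
    ≡ᵇ-true {m} refl = to T-≡ (ℕ.≡⇒≡ᵇ m m refl)

    ≡ᵇ-false : ∀ {m n} → m ≢ n → (m ≡ᵇ n) ≡ false
    ≡ᵇ-false {m} {n} m≢n with m ≡ᵇ n in eq
    ... | false = refl
    ... | true  = ⊥-elim (m≢n (ℕ.≡ᵇ⇒≡ m n (from T-≡ eq)))

  letterWeight-fixed : ∀ p → letterWeight p p ≡ x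
  letterWeight-fixed p rewrite ≡ᵇ-true {p} refl = refl

  letterWeight-above : ∀ {a p} → p < a → letterWeight a p ≡ q
  letterWeight-above p<a rewrite ≡ᵇ-false (ℕ.>⇒≢ p<a) | <ᵇ-true p<a = refl

  letterWeight-below : ∀ {a p} → a < p → letterWeight a p ≡ 1ℤ
  letterWeight-below a<p rewrite ≡ᵇ-false (ℕ.<⇒≢ a<p) | <ᵇ-false (ℕ.<⇒≤ a<p) = refl

  private
    xFixed qExceeding : ℕ → List ℕ → ℤ
    xFixed     p w = x ^ countFrom (λ a i → a ≡ᵇ i) p w
    qExceeding p w = q ^ countFrom (λ a i → i <ᵇ a) p w

    exchange : ∀ a b c → a * (b * c) ≡ b * (a * c)
    exchange = solve-∀

  fp-exc-weight : ∀ p w → xFixed p w * qExceeding p w ≡ weightFrom p w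
  fp-exc-weight p []      = refl
  fp-exc-weight p (a ∷ w) with a ≡ᵇ p in fixed | p <ᵇ a in exceeds
  ... | true  | true  = ⊥-elim (ℕ.<-irrefl (sym (ℕ.≡ᵇ⇒≡ a p (from T-≡ fixed))) (ℕ.<ᵇ⇒< p a (from T-≡ exceeds)))
  ... | true  | false = trans (*-assoc x (xFixed (suc p) w) (qExceeding (suc p) w))
                              (cong (x *_) (fp-exc-weight (suc p) w))
  ... | false | true  = trans (exchange (xFixed (suc p) w) q (qExceeding (suc p) w))
                              (cong (q *_) (fp-exc-weight (suc p) w))
  ... | false | false = trans (sym (*-identityˡ (xFixed (suc p) w * qExceeding (suc p) w)))
                              (cong (1ℤ *_) (fp-exc-weight (suc p) w))

  weightFrom-++ : ∀ p xs ys → weightFrom p (xs ++ ys) ≡ weightFrom p xs * weightFrom (p ℕ.+ length xs) ys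
  weightFrom-++ p []       ys = trans (cong (λ p → weightFrom p ys) (sym (ℕ.+-identityʳ p))) (sym (*-identityˡ _))
  weightFrom-++ p (a ∷ xs) ys =
    trans (cong (letterWeight a p *_) (trans (weightFrom-++ (suc p) xs ys)
            (cong (λ p′ → weightFrom (suc p) xs * weightFrom p′ ys) (sym (ℕ.+-suc p (length xs))))))
          (sym (*-assoc (letterWeight a p) _ _))

  run-snoc : ∀ s m → run s (suc m) ≡ run (suc s) m ++ suc s ∷ []
  run-snoc s zero    = cong (λ t → suc t ∷ []) (ℕ.+-identityʳ s)
  run-snoc s (suc m) = cong₂ _∷_ (cong suc (ℕ.+-suc s m)) (run-snoc s m)

  private
    last-letter : ∀ s p m → suc s < p → weightFrom (p ℕ.+ m) (suc s ∷ []) ≡ 1ℤ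
    last-letter s p m s<p = cong (_* 1ℤ) (letterWeight-below (ℕ.<-≤-trans s<p (ℕ.m≤m+n p m)))

  run-weight-centred : ∀ s m → weightFrom (suc s) (run s m) ≡ reversalWeight m
  run-weight-centred s zero          = refl
  run-weight-centred s (suc zero)    rewrite ℕ.+-identityʳ s | letterWeight-fixed (suc s) = *-identityʳ x
  run-weight-centred s (suc (suc m)) = begin
    letterWeight (suc (s ℕ.+ suc m)) (suc s) * weightFrom (suc (suc s)) (run s (suc m))
      ≡⟨ cong₂ _*_ (letterWeight-above (s≤s (ℕ.m<m+n s (s≤s z≤n))))
                   (trans (cong (weightFrom (suc (suc s))) (run-snoc s m))
                          (weightFrom-++ (suc (suc s)) (run (suc s) m) (suc s ∷ []))) ⟩
    q * (weightFrom (suc (suc s)) (run (suc s) m) * weightFrom (suc (suc s) ℕ.+ length (run (suc s) m)) (suc s ∷ []))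
      ≡⟨ cong (q *_) (cong₂ _*_ (run-weight-centred (suc s) m) (last-letter s (suc (suc s)) _ ℕ.≤-refl)) ⟩
    q * (reversalWeight m * 1ℤ)
      ≡⟨ cong (q *_) (*-identityʳ _) ⟩
    q * reversalWeight m ∎
    where open ≡-Reasoning

  run-weight-above : ∀ s c m → weightFrom (suc s) (run (s ℕ.+ c) m) ≡ q ^ (c ⊓ m) * reversalWeight (m ∸ c)
  run-weight-above s zero    m       rewrite ℕ.+-identityʳ s =
    trans (run-weight-centred s m) (sym (*-identityˡ _))
  run-weight-above s (suc c) zero    = refl
  run-weight-above s (suc c) (suc m) = begin
    letterWeight (suc (s ℕ.+ suc c ℕ.+ m)) (suc s) * weightFrom (suc (suc s)) (run (s ℕ.+ suc c) m)
      ≡⟨ cong₂ _*_ (letterWeight-above (s≤s (ℕ.<-≤-trans (ℕ.m<m+n s (s≤s z≤n)) (ℕ.m≤m+n _ m))))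
                   (cong (λ t → weightFrom (suc (suc s)) (run t m)) (ℕ.+-suc s c)) ⟩
    q * weightFrom (suc (suc s)) (run (suc s ℕ.+ c) m)
      ≡⟨ cong (q *_) (run-weight-above (suc s) c m) ⟩
    q * (q ^ (c ⊓ m) * reversalWeight (m ∸ c))
      ≡⟨ sym (*-assoc q _ _) ⟩
    q ^ (suc c ⊓ suc m) * reversalWeight (suc m ∸ suc c) ∎
    where open ≡-Reasoning

  run-weight-below : ∀ s d m → weightFrom (suc (s ℕ.+ d)) (run s m) ≡ reversalWeight (m ∸ d)
  run-weight-below s zero    m       rewrite ℕ.+-identityʳ s = run-weight-centred s m
  run-weight-below s (suc d) zero    = refl
  run-weight-below s (suc d) (suc m) = begin
    weightFrom (suc (s ℕ.+ suc d)) (run s (suc m))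
      ≡⟨ cong₂ weightFrom (cong suc (ℕ.+-suc s d)) (run-snoc s m) ⟩
    weightFrom (suc (suc s ℕ.+ d)) (run (suc s) m ++ suc s ∷ [])
      ≡⟨ weightFrom-++ _ (run (suc s) m) (suc s ∷ []) ⟩
    weightFrom (suc (suc s ℕ.+ d)) (run (suc s) m) * weightFrom (suc (suc s ℕ.+ d) ℕ.+ length (run (suc s) m)) (suc s ∷ [])
      ≡⟨ cong₂ _*_ (run-weight-below (suc s) d m) (last-letter s _ _ (s≤s (s≤s (ℕ.m≤m+n s d)))) ⟩
    reversalWeight (m ∸ d) * 1ℤ
      ≡⟨ *-identityʳ _ ⟩
    reversalWeight (suc m ∸ suc d) ∎
    where open ≡-Reasoning

  blocks-weight : ∀ i j k → weightFrom 1 (blocks (i , j , k)) ≡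
    (q ^ (i ⊓ j) * reversalWeight (j ∸ i)) * ((q ^ (i ⊓ k) * reversalWeight (k ∸ i)) * reversalWeight (i ∸ (j ℕ.+ k)))
  blocks-weight i j k = begin
    weightFrom 1 (run i j ++ run (i ℕ.+ j) k ++ run 0 i)
      ≡⟨ weightFrom-++ 1 (run i j) _ ⟩
    weightFrom 1 (run i j) * weightFrom (suc (length (run i j))) (run (i ℕ.+ j) k ++ run 0 i)
      ≡⟨ cong (λ l → weightFrom 1 (run i j) * weightFrom (suc l) (run (i ℕ.+ j) k ++ run 0 i)) (length-run i j) ⟩
    weightFrom 1 (run i j) * weightFrom (suc j) (run (i ℕ.+ j) k ++ run 0 i)
      ≡⟨ cong (weightFrom 1 (run i j) *_) (weightFrom-++ (suc j) (run (i ℕ.+ j) k) (run 0 i)) ⟩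
    weightFrom 1 (run i j) * (weightFrom (suc j) (run (i ℕ.+ j) k) * weightFrom (suc j ℕ.+ length (run (i ℕ.+ j) k)) (run 0 i))
      ≡⟨ cong₂ (λ a b → weightFrom 1 (run i j) * (weightFrom (suc j) (run a k) * weightFrom (suc (j ℕ.+ b)) (run 0 i)))
               (ℕ.+-comm i j) (length-run (i ℕ.+ j) k) ⟩
    weightFrom 1 (run i j) * (weightFrom (suc j) (run (j ℕ.+ i) k) * weightFrom (suc (j ℕ.+ k)) (run 0 i))
      ≡⟨ cong₂ _*_ (run-weight-above 0 i j) (cong₂ _*_ (run-weight-above j i k) (run-weight-below 0 (j ℕ.+ k) i)) ⟩
    (q ^ (i ⊓ j) * reversalWeight (j ∸ i)) * ((q ^ (i ⊓ k) * reversalWeight (k ∸ i)) * reversalWeight (i ∸ (j ℕ.+ k))) ∎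
    where open ≡-Reasoning

  blocks-weight-by : ∀ {i j k a b c d e} → i ⊓ j ≡ a → j ∸ i ≡ b → i ⊓ k ≡ c → k ∸ i ≡ d → i ∸ (j ℕ.+ k) ≡ e →
    weightFrom 1 (blocks (i , j , k)) ≡ (q ^ a * reversalWeight b) * ((q ^ c * reversalWeight d) * reversalWeight e)
  blocks-weight-by {i} {j} {k} refl refl refl refl refl = blocks-weight i j k

-- Polynomials in z whose coefficients are ring-solver expressions in x and q, so that an identity
-- between them can be decided by computing normal forms.
module Symbolic (x q : ℤ) where

  open import Data.Nat using (ℕ; zero; suc)
  open import Data.Integer using (_+_; _*_; _^_; 0ℤ; 1ℤ)
  open import Data.Integer.Tactic.RingSolver using (ring)
  open import Tactic.RingSolver.NonReflective ring using (module Ops; Expr; Κ; Ι; _⊕_; _⊗_; ⊝_)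
  import Tactic.RingSolver.Core.Polynomial.Semantics Ops.homo as Semantics
  open import Data.Fin using (zero; suc)
  open import Data.List using (List; []; _∷_; map)
  open import Data.List.Properties using (∷-injectiveˡ; ∷-injectiveʳ)
  open import Data.Vec using ([]; _∷_)
  open import Relation.Binary.PropositionalEquality
  open import Defs
  open Series

  XQ : Set
  XQ = Expr ℤ 2

  Xₑ Qₑ : XQ
  Xₑ = Ι zero
  Qₑ = Ι (suc zero)

  _^ₑ_ : XQ → ℕ → XQ
  e ^ₑ zero  = Κ 1ℤ
  e ^ₑ suc k = e ⊗ (e ^ₑ k)

  ⟦_⟧ₑ : XQ → ℤ
  ⟦ e ⟧ₑ = Ops.⟦ e ⟧ (x ∷ q ∷ [])

  SPoly : Set
  SPoly = List XQ

  ⟦_⟧ₚ : SPoly → Poly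
  ⟦_⟧ₚ = map ⟦_⟧ₑ

  ⟦^ₑ⟧ : ∀ e k → ⟦ e ^ₑ k ⟧ₑ ≡ ⟦ e ⟧ₑ ^ k
  ⟦^ₑ⟧ e zero    = refl
  ⟦^ₑ⟧ e (suc k) = cong (⟦ e ⟧ₑ *_) (⟦^ₑ⟧ e k)

  Eₛ Hₛ : SPoly
  Eₛ = Κ 1ℤ ∷ Κ 0ℤ ∷ ⊝ Qₑ ∷ []
  Hₛ = Κ 1ℤ ∷ Κ 0ℤ ∷ Κ 0ℤ ∷ ⊝ (Qₑ ^ₑ 2) ∷ []

  addS : SPoly → SPoly → SPoly
  addS []      B       = B
  addS A       []      = A
  addS (a ∷ A) (b ∷ B) = (a ⊕ b) ∷ addS A B

  mulS : SPoly → SPoly → SPoly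
  mulS []      B = []
  mulS (a ∷ A) B = addS (map (a ⊗_) B) (Κ 0ℤ ∷ mulS A B)

  productS : List SPoly → SPoly
  productS []       = Κ 1ℤ ∷ []
  productS (A ∷ As) = mulS A (productS As)

  sumS : List SPoly → SPoly
  sumS []       = []
  sumS (A ∷ As) = addS A (sumS As)

  monomialS : ℕ → XQ → SPoly
  monomialS zero    e = e ∷ []
  monomialS (suc d) e = Κ 0ℤ ∷ monomialS d e

  ⟦addS⟧ : ∀ A B → ⟦ addS A B ⟧ₚ ≡ addP ⟦ A ⟧ₚ ⟦ B ⟧ₚ
  ⟦addS⟧ []      B       = refl
  ⟦addS⟧ (a ∷ A) []      = refl
  ⟦addS⟧ (a ∷ A) (b ∷ B) = cong (⟦ a ⟧ₑ + ⟦ b ⟧ₑ ∷_) (⟦addS⟧ A B)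

  ⟦map⊗⟧ : ∀ a B → ⟦ map (a ⊗_) B ⟧ₚ ≡ map (⟦ a ⟧ₑ *_) ⟦ B ⟧ₚ
  ⟦map⊗⟧ a []      = refl
  ⟦map⊗⟧ a (b ∷ B) = cong (⟦ a ⟧ₑ * ⟦ b ⟧ₑ ∷_) (⟦map⊗⟧ a B)

  ⟦mulS⟧ : ∀ A B → ⟦ mulS A B ⟧ₚ ≡ mulP ⟦ A ⟧ₚ ⟦ B ⟧ₚ
  ⟦mulS⟧ []      B = refl
  ⟦mulS⟧ (a ∷ A) B = trans (⟦addS⟧ (map (a ⊗_) B) _) (cong₂ addP (⟦map⊗⟧ a B) (cong (0ℤ ∷_) (⟦mulS⟧ A B)))

  ⟦productS⟧ : ∀ As → ⟦ productS As ⟧ₚ ≡ product (map ⟦_⟧ₚ As)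
  ⟦productS⟧ []       = refl
  ⟦productS⟧ (A ∷ As) = trans (⟦mulS⟧ A (productS As)) (cong (mulP ⟦ A ⟧ₚ) (⟦productS⟧ As))

  ⟦monomialS⟧ : ∀ d e → ⟦ monomialS d e ⟧ₚ ≡ monomial d ⟦ e ⟧ₑ
  ⟦monomialS⟧ zero    e = refl
  ⟦monomialS⟧ (suc d) e = cong (0ℤ ∷_) (⟦monomialS⟧ d e)

  coeff-sumS : ∀ As n → coeff ⟦ sumS As ⟧ₚ n ≡ sumOver (λ A → coeff ⟦ A ⟧ₚ n) As
  coeff-sumS []       n       = refl
  coeff-sumS (A ∷ As) n       = trans (cong (λ P → coeff P n) (⟦addS⟧ A (sumS As)))
    (trans (coeff-addP ⟦ A ⟧ₚ ⟦ sumS As ⟧ₚ n) (cong (λ r → coeff ⟦ A ⟧ₚ n + r) (coeff-sumS As n)))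

  same-normal-form : ∀ A B → map Ops.norm A ≡ map Ops.norm B → ∀ n → coeff ⟦ A ⟧ₚ n ≡ coeff ⟦ B ⟧ₚ n
  same-normal-form []      []      _  n       = refl
  same-normal-form (a ∷ A) (b ∷ B) eq zero    =
    trans (sym (Ops.correct a ρ)) (trans (cong (λ p → Semantics.⟦ p ⟧ ρ) (∷-injectiveˡ eq)) (Ops.correct b ρ))
    where ρ = x ∷ q ∷ []
  same-normal-form (a ∷ A) (b ∷ B) eq (suc n) = same-normal-form A B (∷-injectiveʳ eq) n

module GeneratingFunction (x q : ℤ) where

  open import Data.Nat as ℕ using (ℕ; zero; suc; _∸_; _≤_; s≤s)
  import Data.Nat.Properties as ℕ
  open import Data.Integer using (+_; -_; _+_; _*_; _^_; 0ℤ; 1ℤ)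
  open import Data.Integer.Properties using (^-distribˡ-+-*; *-assoc; *-identityˡ; +-identityʳ; +-identityˡ)
  open import Data.Integer.Tactic.RingSolver using (solve-∀; ring)
  open import Tactic.RingSolver.NonReflective ring using (Κ; _⊕_; _⊗_; ⊝_)
  open import Data.List.Properties using (map-++)
  open import Data.List.Relation.Binary.Permutation.Propositional using (_↭_; ↭-refl)
  import Data.List.Relation.Binary.Permutation.Propositional.Properties as Perm
  open Perm using (++-comm)
  open import Data.List using (List; []; _∷_; _++_; map)
  open import Data.Vec using ([]; _∷_)
  open import Relation.Binary.PropositionalEquality
  open import Defs
  open Blocks using (blocks)
  open Avoidance using (Σ₀)
  open Counting using (SymAv↭blocks)
  open import Function using (_∘_)
  open Classes
  open Series
  open Weights x q
  open Symbolic x q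

  μ : Kind → ℕ → ℤ
  μ geom₂   a = q ^ a
  μ geom₃   a = q ^ a * q ^ a
  μ (dec s) a = reversalWeight (s ℕ.+ a)

  weight : ∀ ks → Exponents ks → ℤ
  weight []       []      = 1ℤ
  weight (k ∷ ks) (a ∷ e) = μ k a * weight ks e

  series : List Kind → Seq
  series ks n = sumOver (weight ks) (vectors ks n)

  -- The region of the class fixes the minima and differences in blocks-weight.
  class-weight : ∀ c e → weightFrom 1 (blocks (triple c e)) ≡ q ^ qPower c * weight (kinds c) e
  class-weight reversal (a ∷ []) rewrite blocks-weight 0 0 a | ℕ.0∸n≡0 a = factor (reversalWeight a)
    where factor : ∀ z → 1ℤ * 1ℤ * (1ℤ * z * 1ℤ) ≡ 1ℤ * (z * 1ℤ)
          factor = solve-∀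
  class-weight noTail (a ∷ b ∷ []) rewrite blocks-weight 0 (suc a) (suc b) =
    factor (reversalWeight (suc a)) (reversalWeight (suc b))
    where factor : ∀ y z → 1ℤ * y * (1ℤ * z * 1ℤ) ≡ 1ℤ * (y * (z * 1ℤ))
          factor = solve-∀
  class-weight iSmall (a ∷ b ∷ w ∷ []) =
    trans (blocks-weight-by (ℕ.m≤n⇒m⊓n≡m (s≤s (ℕ.m≤m+n w a))) (ℕ.m+n∸m≡n w a)
                            (ℕ.m≤n⇒m⊓n≡m (s≤s (ℕ.m≤m+n w b))) (ℕ.m+n∸m≡n w b)
                            (ℕ.m≤n⇒m∸n≡0 (ℕ.≤-trans (ℕ.m≤m+n w a) (ℕ.m≤m+n (w ℕ.+ a) (suc (w ℕ.+ b))))))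
          (factor q (q ^ w) (reversalWeight a) (reversalWeight b))
    where factor : ∀ q Q y z → q * Q * y * (q * Q * z * 1ℤ) ≡ q * (q * 1ℤ) * (y * (z * (Q * Q * 1ℤ)))
          factor = solve-∀
  class-weight jSmall (c ∷ b ∷ w ∷ []) =
    trans (blocks-weight-by (ℕ.m≥n⇒m⊓n≡n j≤i) (ℕ.m≤n⇒m∸n≡0 j≤i)
                            (ℕ.m≤n⇒m⊓n≡m (s≤s (ℕ.m≤m+n (suc w ℕ.+ c) b))) (ℕ.m+n∸m≡n (w ℕ.+ c) b)
                            (ℕ.m≤n⇒m∸n≡0 (ℕ.≤-trans (s≤s (ℕ.m≤m+n (suc w ℕ.+ c) b)) (ℕ.m≤n+m _ (suc w)))))
    (trans (cong (λ P → q * q ^ w * 1ℤ * (q * (q * P) * reversalWeight b * 1ℤ)) (^-distribˡ-+-* q w c))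
           (factor q (q ^ w) (q ^ c) (reversalWeight b)))
    where j≤i : suc w ≤ suc (suc w ℕ.+ c)
          j≤i = ℕ.m≤n⇒m≤1+n (ℕ.m≤m+n (suc w) c)
          factor : ∀ q Q C z → q * Q * 1ℤ * (q * (q * (Q * C)) * z * 1ℤ) ≡
                               q * (q * (q * 1ℤ)) * (C * (z * (Q * Q * 1ℤ)))
          factor = solve-∀
  class-weight kSmall (c ∷ b ∷ w ∷ []) =
    trans (blocks-weight-by (ℕ.m≤n⇒m⊓n≡m (s≤s (ℕ.m≤m+n (suc w ℕ.+ c) b))) (ℕ.m+n∸m≡n (w ℕ.+ c) b)
                            (ℕ.m≥n⇒m⊓n≡n k≤i) (ℕ.m≤n⇒m∸n≡0 k≤i)
                            (ℕ.m≤n⇒m∸n≡0 (ℕ.≤-trans (s≤s (ℕ.m≤m+n (suc w ℕ.+ c) b)) (ℕ.m≤m+n _ (suc w)))))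
    (trans (cong (λ P → q * (q * P) * reversalWeight b * (q * q ^ w * 1ℤ * 1ℤ)) (^-distribˡ-+-* q w c))
           (factor q (q ^ w) (q ^ c) (reversalWeight b)))
    where k≤i : suc w ≤ suc (suc w ℕ.+ c)
          k≤i = ℕ.m≤n⇒m≤1+n (ℕ.m≤m+n (suc w) c)
          factor : ∀ q Q C z → q * (q * (Q * C)) * z * (q * Q * 1ℤ * 1ℤ) ≡
                               q * (q * (q * 1ℤ)) * (C * (z * (Q * Q * 1ℤ)))
          factor = solve-∀
  class-weight iMedium (u ∷ v ∷ w ∷ []) =
    trans (blocks-weight-by (ℕ.m≥n⇒m⊓n≡n j≤i) (ℕ.m≤n⇒m∸n≡0 j≤i) (ℕ.m≥n⇒m⊓n≡n k≤i) (ℕ.m≤n⇒m∸n≡0 k≤i)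
                            (ℕ.m≤n⇒m∸n≡0 i≤j+k))
    (trans (cong₂ (λ P R → q * P * 1ℤ * (q * R * 1ℤ * 1ℤ)) (^-distribˡ-+-* q u w) (^-distribˡ-+-* q w v))
           (factor q (q ^ u) (q ^ v) (q ^ w)))
    where j≤i : suc (u ℕ.+ w) ≤ suc (suc (w ℕ.+ v) ℕ.+ u)
          j≤i = s≤s (ℕ.≤-trans (ℕ.≤-reflexive (ℕ.+-comm u w)) (ℕ.m≤n⇒m≤1+n (ℕ.+-monoˡ-≤ u (ℕ.m≤m+n w v))))
          k≤i : suc (w ℕ.+ v) ≤ suc (suc (w ℕ.+ v) ℕ.+ u)
          k≤i = s≤s (ℕ.m≤n⇒m≤1+n (ℕ.m≤m+n (w ℕ.+ v) u))
          i≤j+k : suc (suc (w ℕ.+ v) ℕ.+ u) ≤ suc (u ℕ.+ w) ℕ.+ suc (w ℕ.+ v)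
          i≤j+k = s≤s (ℕ.≤-trans (ℕ.+-monoʳ-≤ (suc (w ℕ.+ v)) (ℕ.m≤m+n u w))
                                 (ℕ.≤-reflexive (ℕ.+-comm (suc (w ℕ.+ v)) (u ℕ.+ w))))
          factor : ∀ q U V W → q * (U * W) * 1ℤ * (q * (W * V) * 1ℤ * 1ℤ) ≡ q * (q * 1ℤ) * (U * (V * (W * W * 1ℤ)))
          factor = solve-∀
  class-weight iLarge (u ∷ v ∷ a ∷ []) =
    trans (blocks-weight-by (ℕ.m≥n⇒m⊓n≡n j≤i) (ℕ.m≤n⇒m∸n≡0 j≤i) (ℕ.m≥n⇒m⊓n≡n k≤i) (ℕ.m≤n⇒m∸n≡0 k≤i)
                            i∸[j+k])
          (factor q (q ^ u) (q ^ v) (reversalWeight (suc a)))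
    where j≤i : suc u ≤ suc (suc u ℕ.+ suc v ℕ.+ a)
          j≤i = ℕ.m≤n⇒m≤1+n (ℕ.≤-trans (ℕ.m≤m+n (suc u) (suc v)) (ℕ.m≤m+n _ a))
          k≤i : suc v ≤ suc (suc u ℕ.+ suc v ℕ.+ a)
          k≤i = ℕ.m≤n⇒m≤1+n (ℕ.≤-trans (ℕ.m≤n+m (suc v) (suc u)) (ℕ.m≤m+n _ a))
          i∸[j+k] : suc (suc u ℕ.+ suc v ℕ.+ a) ∸ (suc u ℕ.+ suc v) ≡ suc a
          i∸[j+k] = trans (cong (_∸ (suc u ℕ.+ suc v)) (sym (ℕ.+-suc (suc u ℕ.+ suc v) a)))
                          (ℕ.m+n∸m≡n (suc u ℕ.+ suc v) (suc a))
          factor : ∀ q U V z → q * U * 1ℤ * (q * V * 1ℤ * z) ≡ q * (q * 1ℤ) * (U * (V * (z * 1ℤ)))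
          factor = solve-∀

  sumOver-delayed : ∀ {A : Set} d c (w : A → ℤ) (L : ℕ → List A) n →
                    sumOver (λ e → c * w e) (delayed d L n) ≡ act (monomial d c) (λ m → sumOver w (L m)) n
  sumOver-delayed zero    c w L zero    = sumOver-scale c w (L zero)
  sumOver-delayed zero    c w L (suc n) = trans (sumOver-scale c w (L (suc n))) (sym (+-identityʳ _))
  sumOver-delayed (suc d) c w L zero    = refl
  sumOver-delayed (suc d) c w L (suc n) = trans (sumOver-delayed d c w L n) (sym (+-identityˡ _))

  classSeries : Class → Seq
  classSeries c = act (monomial (offset c) (q ^ qPower c)) (series (kinds c))

  Fcoeff≡classSeries : ∀ n → Fcoeff Σ₀ x q n ≡ sumOver (λ c → classSeries c n) allClasses
  Fcoeff≡classSeries n = begin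
    sumOver (λ π → x ^ fp π * q ^ exc π) (SymAv Σ₀ n)
      ≡⟨ sumOver-cong (SymAv Σ₀ n) (λ {π} _ → fp-exc-weight 1 π) ⟩
    sumOver (weightFrom 1) (SymAv Σ₀ n)
      ≡⟨ sumOver-↭ (weightFrom 1) (SymAv↭blocks n) ⟩
    sumOver (weightFrom 1) (map blocks (classTriples n))
      ≡⟨ sumOver-map (weightFrom 1) blocks (classTriples n) ⟩
    sumOver (weightFrom 1 ∘ blocks) (classTriples n)
      ≡⟨ sumOver-concatMap (weightFrom 1 ∘ blocks) (λ c → map (triple c) (classVectors c n)) allClasses ⟩
    sumOver (λ c → sumOver (weightFrom 1 ∘ blocks) (map (triple c) (classVectors c n))) allClasses
      ≡⟨ sumOver-cong allClasses (λ {c} _ → class-sum c) ⟩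
    sumOver (λ c → classSeries c n) allClasses ∎
    where
    open ≡-Reasoning
    class-sum : ∀ c → sumOver (weightFrom 1 ∘ blocks) (map (triple c) (classVectors c n)) ≡ classSeries c n
    class-sum c = begin
      sumOver (weightFrom 1 ∘ blocks) (map (triple c) (classVectors c n))
        ≡⟨ sumOver-map (weightFrom 1 ∘ blocks) (triple c) (classVectors c n) ⟩
      sumOver (weightFrom 1 ∘ blocks ∘ triple c) (classVectors c n)
        ≡⟨ sumOver-cong (classVectors c n) (λ {e} _ → class-weight c e) ⟩
      sumOver (λ e → q ^ qPower c * weight (kinds c) e) (classVectors c n)
        ≡⟨ sumOver-delayed (offset c) (q ^ qPower c) (weight (kinds c)) (vectors (kinds c)) n ⟩
      classSeries c n ∎

  private
    series-cons : ∀ k ks c L → sumOver (weight (k ∷ ks)) (map (c ∷_) L) ≡ μ k c * sumOver (weight ks) L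
    series-cons k ks c L = trans (sumOver-map (weight (k ∷ ks)) (c ∷_) L) (sumOver-scale (μ k c) (weight ks) L)

    series-scaled : ∀ ks r (f : Exponents ks → Exponents ks) L → (∀ e → weight ks (f e) ≡ r * weight ks e) →
                    sumOver (weight ks) (map f L) ≡ r * sumOver (weight ks) L
    series-scaled ks r f L scaled =
      trans (sumOver-map (weight ks) f L) (trans (sumOver-cong L (λ {e} _ → scaled e)) (sumOver-scale r (weight ks) L))

    series-bump : ∀ k ks r L → (∀ a → μ k (suc a) ≡ r * μ k a) →
                  sumOver (weight (k ∷ ks)) (map bump L) ≡ r * sumOver (weight (k ∷ ks)) L
    series-bump k ks r L step =
      series-scaled (k ∷ ks) r bump L λ { (a ∷ e) → trans (cong (_* weight ks e) (step a)) (*-assoc r _ _) }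

    series-bump₂ : ∀ k ks r L → (∀ a → μ k (suc (suc a)) ≡ r * μ k a) →
                   sumOver (weight (k ∷ ks)) (map bump₂ L) ≡ r * sumOver (weight (k ∷ ks)) L
    series-bump₂ k ks r L step =
      series-scaled (k ∷ ks) r bump₂ L λ { (a ∷ e) → trans (cong (_* weight ks e) (step a)) (*-assoc r _ _) }

  reversalWeightₑ : ℕ → XQ
  reversalWeightₑ zero          = Κ 1ℤ
  reversalWeightₑ (suc zero)    = Xₑ
  reversalWeightₑ (suc (suc n)) = Qₑ ⊗ reversalWeightₑ n

  ⟦reversalWeightₑ⟧ : ∀ n → ⟦ reversalWeightₑ n ⟧ₑ ≡ reversalWeight n
  ⟦reversalWeightₑ⟧ zero          = refl
  ⟦reversalWeightₑ⟧ (suc zero)    = refl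
  ⟦reversalWeightₑ⟧ (suc (suc n)) = cong (q *_) (⟦reversalWeightₑ⟧ n)

  -- Generating function of a kind: num k / den k.
  den num : Kind → SPoly
  den geom₂   = Eₛ
  den geom₃   = Hₛ
  den (dec _) = Eₛ
  num geom₂   = Κ 1ℤ ∷ []
  num geom₃   = Κ 1ℤ ∷ []
  num (dec s) = reversalWeightₑ s ∷ reversalWeightₑ (suc s) ∷ []

  private
    dec-step : ∀ s a → μ (dec s) (suc (suc a)) ≡ q * μ (dec s) a
    dec-step s a rewrite ℕ.+-suc s (suc a) | ℕ.+-suc s a = refl

    ⟦num-dec⟧₀ : ∀ s → ⟦ reversalWeightₑ s ⟧ₑ ≡ μ (dec s) 0
    ⟦num-dec⟧₀ s = trans (⟦reversalWeightₑ⟧ s) (cong reversalWeight (sym (ℕ.+-identityʳ s)))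

    ⟦num-dec⟧₁ : ∀ s → ⟦ reversalWeightₑ (suc s) ⟧ₑ ≡ μ (dec s) 1
    ⟦num-dec⟧₁ s = trans (⟦reversalWeightₑ⟧ (suc s)) (cong reversalWeight (sym (ℕ.+-comm s 1)))

  den-num : ∀ k ks → act ⟦ den k ⟧ₚ (series (k ∷ ks)) ≗ act ⟦ num k ⟧ₚ (series ks)
  den-num geom₂ ks zero = cong (1ℤ *_) (trans (series-cons geom₂ ks 0 (vectors ks 0)) (*-identityˡ _))
  den-num geom₂ ks (suc zero) =
    trans (cong (λ S → 1ℤ * S + 0ℤ * series (geom₂ ∷ ks) 0) (series-cons geom₂ ks 0 (vectors ks 1)))
          (identity (series ks 1) (series (geom₂ ∷ ks) 0))
    where identity : ∀ t s → 1ℤ * (1ℤ * t) + 0ℤ * s ≡ 1ℤ * t + 0ℤ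
          identity = solve-∀
  den-num geom₂ ks (suc (suc n)) = begin
    act ⟦ Eₛ ⟧ₚ S (2 ℕ.+ n)
      ≡⟨ act-3 1ℤ 0ℤ (- q) S n ⟩
    1ℤ * S (2 ℕ.+ n) + (0ℤ * S (1 ℕ.+ n) + - q * S n)
      ≡⟨ cong (λ r → 1ℤ * r + (0ℤ * S (1 ℕ.+ n) + - q * S n)) recurrence ⟩
    1ℤ * (1ℤ * T (2 ℕ.+ n) + q * S n) + (0ℤ * S (1 ℕ.+ n) + - q * S n)
      ≡⟨ cancel q (T (2 ℕ.+ n)) (S n) (S (1 ℕ.+ n)) ⟩
    1ℤ * T (2 ℕ.+ n)
      ≡⟨ act-1 1ℤ T (2 ℕ.+ n) ⟨
    act (1ℤ ∷ []) T (2 ℕ.+ n) ∎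
    where
    open ≡-Reasoning
    S = series (geom₂ ∷ ks)
    T = series ks
    recurrence : S (2 ℕ.+ n) ≡ 1ℤ * T (2 ℕ.+ n) + q * S n
    recurrence =
      trans (sumOver-++ (weight (geom₂ ∷ ks)) (map (0 ∷_) (vectors ks (2 ℕ.+ n))) (map bump (vectors (geom₂ ∷ ks) n)))
            (cong₂ _+_ (series-cons geom₂ ks 0 (vectors ks (2 ℕ.+ n)))
                       (series-bump geom₂ ks q (vectors (geom₂ ∷ ks) n) (λ _ → refl)))
    cancel : ∀ q t s s′ → 1ℤ * (1ℤ * t + q * s) + (0ℤ * s′ + - q * s) ≡ 1ℤ * t
    cancel = solve-∀
  den-num geom₃ ks zero = cong (1ℤ *_) (trans (series-cons geom₃ ks 0 (vectors ks 0)) (*-identityˡ _))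
  den-num geom₃ ks (suc zero) =
    trans (cong (λ S → 1ℤ * S + 0ℤ * series (geom₃ ∷ ks) 0) (series-cons geom₃ ks 0 (vectors ks 1)))
          (identity (series ks 1) (series (geom₃ ∷ ks) 0))
    where identity : ∀ t s → 1ℤ * (1ℤ * t) + 0ℤ * s ≡ 1ℤ * t + 0ℤ
          identity = solve-∀
  den-num geom₃ ks (suc (suc zero)) =
    trans (cong (λ S → 1ℤ * S + (0ℤ * series (geom₃ ∷ ks) 1 + 0ℤ * series (geom₃ ∷ ks) 0))
                (series-cons geom₃ ks 0 (vectors ks 2)))
          (identity (series ks 2) (series (geom₃ ∷ ks) 1) (series (geom₃ ∷ ks) 0))
    where identity : ∀ t s s′ → 1ℤ * (1ℤ * t) + (0ℤ * s + 0ℤ * s′) ≡ 1ℤ * t + 0ℤ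
          identity = solve-∀
  den-num geom₃ ks (suc (suc (suc n))) = begin
    act ⟦ Hₛ ⟧ₚ S (3 ℕ.+ n)
      ≡⟨ act-4 1ℤ 0ℤ 0ℤ (- (q * (q * 1ℤ))) S n ⟩
    1ℤ * S (3 ℕ.+ n) + (0ℤ * S (2 ℕ.+ n) + (0ℤ * S (1 ℕ.+ n) + - (q * (q * 1ℤ)) * S n))
      ≡⟨ cong (λ r → 1ℤ * r + (0ℤ * S (2 ℕ.+ n) + (0ℤ * S (1 ℕ.+ n) + - (q * (q * 1ℤ)) * S n))) recurrence ⟩
    1ℤ * (1ℤ * T (3 ℕ.+ n) + q * q * S n) + (0ℤ * S (2 ℕ.+ n) + (0ℤ * S (1 ℕ.+ n) + - (q * (q * 1ℤ)) * S n))
      ≡⟨ cancel q (T (3 ℕ.+ n)) (S n) (S (2 ℕ.+ n)) (S (1 ℕ.+ n)) ⟩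
    1ℤ * T (3 ℕ.+ n)
      ≡⟨ act-1 1ℤ T (3 ℕ.+ n) ⟨
    act (1ℤ ∷ []) T (3 ℕ.+ n) ∎
    where
    open ≡-Reasoning
    S = series (geom₃ ∷ ks)
    T = series ks
    step : ∀ a → μ geom₃ (suc a) ≡ q * q * μ geom₃ a
    step a = square q (q ^ a)
      where square : ∀ q Q → q * Q * (q * Q) ≡ q * q * (Q * Q)
            square = solve-∀
    recurrence : S (3 ℕ.+ n) ≡ 1ℤ * T (3 ℕ.+ n) + q * q * S n
    recurrence =
      trans (sumOver-++ (weight (geom₃ ∷ ks)) (map (0 ∷_) (vectors ks (3 ℕ.+ n))) (map bump (vectors (geom₃ ∷ ks) n)))
            (cong₂ _+_ (series-cons geom₃ ks 0 (vectors ks (3 ℕ.+ n)))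
                       (series-bump geom₃ ks (q * q) (vectors (geom₃ ∷ ks) n) step))
    cancel : ∀ q t s s′ s″ →
             1ℤ * (1ℤ * t + q * q * s) + (0ℤ * s′ + (0ℤ * s″ + - (q * (q * 1ℤ)) * s)) ≡ 1ℤ * t
    cancel = solve-∀
  den-num (dec s) ks zero =
    trans (cong (1ℤ *_) (series-cons (dec s) ks 0 (vectors ks 0)))
          (trans (*-identityˡ _) (cong (_* series ks 0) (sym (⟦num-dec⟧₀ s))))
  den-num (dec s) ks (suc zero) = begin
    1ℤ * S 1 + 0ℤ * S 0
      ≡⟨ cong (λ r → 1ℤ * r + 0ℤ * S 0) recurrence ⟩
    1ℤ * (μ (dec s) 0 * T 1 + μ (dec s) 1 * T 0) + 0ℤ * S 0
      ≡⟨ identity (μ (dec s) 0) (μ (dec s) 1) (T 1) (T 0) (S 0) ⟩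
    μ (dec s) 0 * T 1 + μ (dec s) 1 * T 0
      ≡⟨ cong₂ (λ a b → a * T 1 + b * T 0) (sym (⟦num-dec⟧₀ s)) (sym (⟦num-dec⟧₁ s)) ⟩
    act ⟦ num (dec s) ⟧ₚ T 1 ∎
    where
    open ≡-Reasoning
    S = series (dec s ∷ ks)
    T = series ks
    recurrence : S 1 ≡ μ (dec s) 0 * T 1 + μ (dec s) 1 * T 0
    recurrence = trans (sumOver-++ (weight (dec s ∷ ks)) (map (0 ∷_) (vectors ks 1)) (map (1 ∷_) (vectors ks 0)))
      (cong₂ _+_ (series-cons (dec s) ks 0 (vectors ks 1)) (series-cons (dec s) ks 1 (vectors ks 0)))
    identity : ∀ a b t t′ s → 1ℤ * (a * t + b * t′) + 0ℤ * s ≡ a * t + b * t′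
    identity = solve-∀
  den-num (dec s) ks (suc (suc n)) = begin
    act ⟦ Eₛ ⟧ₚ S (2 ℕ.+ n)
      ≡⟨ act-3 1ℤ 0ℤ (- q) S n ⟩
    1ℤ * S (2 ℕ.+ n) + (0ℤ * S (1 ℕ.+ n) + - q * S n)
      ≡⟨ cong (λ r → 1ℤ * r + (0ℤ * S (1 ℕ.+ n) + - q * S n)) recurrence ⟩
    1ℤ * (μ (dec s) 0 * T (2 ℕ.+ n) + (μ (dec s) 1 * T (1 ℕ.+ n) + q * S n)) + (0ℤ * S (1 ℕ.+ n) + - q * S n)
      ≡⟨ cancel q (μ (dec s) 0) (μ (dec s) 1) (T (2 ℕ.+ n)) (T (1 ℕ.+ n)) (S n) (S (1 ℕ.+ n)) ⟩
    μ (dec s) 0 * T (2 ℕ.+ n) + μ (dec s) 1 * T (1 ℕ.+ n)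
      ≡⟨ cong₂ (λ a b → a * T (2 ℕ.+ n) + b * T (1 ℕ.+ n)) (sym (⟦num-dec⟧₀ s)) (sym (⟦num-dec⟧₁ s)) ⟩
    ⟦ reversalWeightₑ s ⟧ₑ * T (2 ℕ.+ n) + ⟦ reversalWeightₑ (suc s) ⟧ₑ * T (1 ℕ.+ n)
      ≡⟨ act-2 ⟦ reversalWeightₑ s ⟧ₑ ⟦ reversalWeightₑ (suc s) ⟧ₑ T (suc n) ⟨
    act ⟦ num (dec s) ⟧ₚ T (2 ℕ.+ n) ∎
    where
    open ≡-Reasoning
    S = series (dec s ∷ ks)
    T = series ks
    recurrence : S (2 ℕ.+ n) ≡ μ (dec s) 0 * T (2 ℕ.+ n) + (μ (dec s) 1 * T (1 ℕ.+ n) + q * S n)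
    recurrence = trans (sumOver-++ (weight (dec s ∷ ks)) (map (0 ∷_) (vectors ks (2 ℕ.+ n)))
                                   (map (1 ∷_) (vectors ks (1 ℕ.+ n)) ++ map bump₂ (vectors (dec s ∷ ks) n)))
      (cong₂ _+_ (series-cons (dec s) ks 0 (vectors ks (2 ℕ.+ n)))
                 (trans (sumOver-++ (weight (dec s ∷ ks)) (map (1 ∷_) (vectors ks (1 ℕ.+ n)))
                                    (map bump₂ (vectors (dec s ∷ ks) n)))
                        (cong₂ _+_ (series-cons (dec s) ks 1 (vectors ks (1 ℕ.+ n)))
                                   (series-bump₂ (dec s) ks q (vectors (dec s ∷ ks) n) (dec-step s)))))
    cancel : ∀ q a b t t′ s s′ → 1ℤ * (a * t + (b * t′ + q * s)) + (0ℤ * s′ + - q * s) ≡ a * t + b * t′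
    cancel = solve-∀

  series-rational : ∀ ks → actAll (map ⟦_⟧ₚ (map den ks)) (series ks) ≗ actAll (map ⟦_⟧ₚ (map num ks)) δ
  series-rational []       zero    = refl
  series-rational []       (suc n) = refl
  series-rational (k ∷ ks) n = begin
    act ⟦ den k ⟧ₚ (actAll dens (series (k ∷ ks))) n    ≡⟨ act-actAll ⟦ den k ⟧ₚ dens _ n ⟩
    actAll dens (act ⟦ den k ⟧ₚ (series (k ∷ ks))) n    ≡⟨ actAll-cong dens (den-num k ks) n ⟩
    actAll dens (act ⟦ num k ⟧ₚ (series ks)) n          ≡⟨ act-actAll ⟦ num k ⟧ₚ dens _ n ⟨
    act ⟦ num k ⟧ₚ (actAll dens (series ks)) n          ≡⟨ act-cong ⟦ num k ⟧ₚ (series-rational ks) n ⟩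
    act ⟦ num k ⟧ₚ (actAll (map ⟦_⟧ₚ (map num ks)) δ) n   ∎
    where
    open ≡-Reasoning
    dens = map ⟦_⟧ₚ (map den ks)

  denominator : List SPoly
  denominator = Eₛ ∷ Eₛ ∷ Eₛ ∷ Hₛ ∷ []

  -- The factors of the denominator (1 − q z²)³ (1 − q² z³) that a class does not consume.
  complement : Class → List SPoly
  complement reversal = Eₛ ∷ Eₛ ∷ Hₛ ∷ []
  complement noTail   = Eₛ ∷ Hₛ ∷ []
  complement iSmall   = Eₛ ∷ []
  complement jSmall   = Eₛ ∷ []
  complement kSmall   = Eₛ ∷ []
  complement iMedium  = Eₛ ∷ []
  complement iLarge   = Hₛ ∷ []

  denominator-split : ∀ c → denominator ↭ complement c ++ map den (kinds c)
  denominator-split reversal = ++-comm (map den (kinds reversal)) (complement reversal)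
  denominator-split noTail   = ++-comm (map den (kinds noTail)) (complement noTail)
  denominator-split iSmall   = ↭-refl
  denominator-split jSmall   = ↭-refl
  denominator-split kSmall   = ↭-refl
  denominator-split iMedium  = ↭-refl
  denominator-split iLarge   = ++-comm (map den (kinds iLarge)) (complement iLarge)

  classNumerator : Class → SPoly
  classNumerator c = productS (complement c ++ monomialS (offset c) (Qₑ ^ₑ qPower c) ∷ map num (kinds c))

  class-identity : ∀ c → actAll (map ⟦_⟧ₚ denominator) (classSeries c) ≗ coeff ⟦ classNumerator c ⟧ₚ
  class-identity c n = begin
    actAll (map ⟦_⟧ₚ denominator) (classSeries c) n
      ≡⟨ actAll-↭ (classSeries c) (Perm.map⁺ ⟦_⟧ₚ (denominator-split c)) n ⟩
    actAll (map ⟦_⟧ₚ (complement c ++ map den ks)) (classSeries c) n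
      ≡⟨ cong (λ f → f n) (trans (cong (λ Ps → actAll Ps (classSeries c)) (map-++ ⟦_⟧ₚ (complement c) (map den ks)))
                                (actAll-++ C Ds (classSeries c))) ⟩
    actAll C (actAll Ds (classSeries c)) n
      ≡⟨ cong (λ P → actAll C (actAll Ds (act P (series ks))) n)
              (sym (trans (⟦monomialS⟧ (offset c) _) (cong (monomial (offset c)) (⟦^ₑ⟧ Qₑ (qPower c))))) ⟩
    actAll C (actAll Ds (act ⟦ B ⟧ₚ (series ks))) n
      ≡⟨ actAll-cong C (λ m → trans (sym (act-actAll ⟦ B ⟧ₚ Ds (series ks) m))
                                    (act-cong ⟦ B ⟧ₚ (series-rational ks) m)) n ⟩
    actAll C (act ⟦ B ⟧ₚ (actAll Ns δ)) n
      ≡⟨ cong (λ f → f n) (sym (actAll-++ C (⟦ B ⟧ₚ ∷ Ns) δ)) ⟩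
    actAll (C ++ ⟦ B ⟧ₚ ∷ Ns) δ n
      ≡⟨ actAll-δ (C ++ ⟦ B ⟧ₚ ∷ Ns) n ⟩
    coeff (product (C ++ ⟦ B ⟧ₚ ∷ Ns)) n
      ≡⟨ cong (λ Ps → coeff (product Ps) n) (sym (map-++ ⟦_⟧ₚ (complement c) (B ∷ map num ks))) ⟩
    coeff (product (map ⟦_⟧ₚ (complement c ++ B ∷ map num ks))) n
      ≡⟨ cong (λ P → coeff P n) (sym (⟦productS⟧ (complement c ++ B ∷ map num ks))) ⟩
    coeff ⟦ classNumerator c ⟧ₚ n ∎
    where
    open ≡-Reasoning
    ks = kinds c
    B = monomialS (offset c) (Qₑ ^ₑ qPower c)
    C = map ⟦_⟧ₚ (complement c)
    Ds = map ⟦_⟧ₚ (map den ks)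
    Ns = map ⟦_⟧ₚ (map num ks)

  numerator : SPoly
  numerator = Κ 1ℤ
            ∷ Xₑ
            ∷ (Xₑ ^ₑ 2 ⊕ ⊝ (Κ (+ 2) ⊗ Qₑ))
            ∷ Κ 0ℤ
            ∷ (⊝ (Xₑ ^ₑ 2 ⊗ Qₑ) ⊕ Xₑ ⊗ Qₑ ^ₑ 2 ⊕ Κ (+ 3) ⊗ Qₑ ^ₑ 2)
            ∷ Κ (+ 3) ⊗ Qₑ ^ₑ 3
            ∷ ⊝ (Qₑ ^ₑ 3)
            ∷ ⊝ (Κ (+ 4) ⊗ Qₑ ^ₑ 4)
            ∷ ⊝ (Κ (+ 2) ⊗ Xₑ ⊗ Qₑ ^ₑ 4)
            ∷ []

  -- The sum of the class numerators has a vanishing coefficient of z⁹, which the numerator lacks;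
  -- the identity is checked by comparing normal forms coefficientwise.
  numerators-sum : ∀ n → sumOver (λ c → coeff ⟦ classNumerator c ⟧ₚ n) allClasses ≡ coeff ⟦ numerator ⟧ₚ n
  numerators-sum n = begin
    sumOver (λ c → coeff ⟦ classNumerator c ⟧ₚ n) allClasses
      ≡⟨ sumOver-map (λ A → coeff ⟦ A ⟧ₚ n) classNumerator allClasses ⟨
    sumOver (λ A → coeff ⟦ A ⟧ₚ n) (map classNumerator allClasses)
      ≡⟨ coeff-sumS (map classNumerator allClasses) n ⟨
    coeff ⟦ sumS (map classNumerator allClasses) ⟧ₚ n
      ≡⟨ same-normal-form (sumS (map classNumerator allClasses)) (numerator ++ Κ 0ℤ ∷ []) refl n ⟩
    coeff ⟦ numerator ++ Κ 0ℤ ∷ [] ⟧ₚ n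
      ≡⟨ cong (λ P → coeff P n) (map-++ ⟦_⟧ₑ numerator (Κ 0ℤ ∷ [])) ⟩
    coeff (⟦ numerator ⟧ₚ ++ 0ℤ ∷ []) n
      ≡⟨ coeff-padded ⟦ numerator ⟧ₚ n ⟩
    coeff ⟦ numerator ⟧ₚ n ∎
    where open ≡-Reasoning

  act-denominator : ∀ f → act (mulP (mulP (mulP ⟦ Eₛ ⟧ₚ ⟦ Eₛ ⟧ₚ) ⟦ Eₛ ⟧ₚ) ⟦ Hₛ ⟧ₚ) f ≗
                          actAll (map ⟦_⟧ₚ denominator) f
  act-denominator f n =
    trans (act-mulP (mulP (mulP ⟦ Eₛ ⟧ₚ ⟦ Eₛ ⟧ₚ) ⟦ Eₛ ⟧ₚ) ⟦ Hₛ ⟧ₚ f n)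
    (trans (act-mulP (mulP ⟦ Eₛ ⟧ₚ ⟦ Eₛ ⟧ₚ) ⟦ Eₛ ⟧ₚ (act ⟦ Hₛ ⟧ₚ f) n)
           (act-mulP ⟦ Eₛ ⟧ₚ ⟦ Eₛ ⟧ₚ (act ⟦ Eₛ ⟧ₚ (act ⟦ Hₛ ⟧ₚ f)) n))

open import Defs
open import Data.Nat using (ℕ)
open import Data.Integer using (ℤ; +_; -_; _+_; _*_; _^_)
open import Data.List using (List; []; _∷_; map)
open import Relation.Binary.PropositionalEquality using (_≡_; module ≡-Reasoning)

proposition4p12 :
    (x q : ℤ) (n : ℕ) →
    seriesMulCoeff
      (mulP (mulP (mulP (+ 1 ∷ + 0 ∷ - q ∷ []) (+ 1 ∷ + 0 ∷ - q ∷ []))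
                  (+ 1 ∷ + 0 ∷ - q ∷ []))
            (+ 1 ∷ + 0 ∷ + 0 ∷ - (q ^ 2) ∷ []))
      (Fcoeff ((1 ∷ 2 ∷ 3 ∷ []) ∷ (3 ∷ 1 ∷ 2 ∷ []) ∷ []) x q)
      n
    ≡
    coeff
      (+ 1
       ∷ x
       ∷ (x ^ 2 + - (+ 2 * q))
       ∷ + 0
       ∷ (- (x ^ 2 * q) + x * q ^ 2 + + 3 * q ^ 2)
       ∷ + 3 * q ^ 3
       ∷ - (q ^ 3)
       ∷ - (+ 4 * q ^ 4)
       ∷ - (+ 2 * x * q ^ 4)
       ∷ [])
      n
proposition4p12 x q n = begin
  seriesMulCoeff D F n
    ≡⟨ seriesMulCoeff≡act D F n ⟩
  act D F n
    ≡⟨ act-denominator F n ⟩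
  actAll Dl F n
    ≡⟨ actAll-cong Dl Fcoeff≡classSeries n ⟩
  actAll Dl (λ m → sumOver (λ c → classSeries c m) allClasses) n
    ≡⟨ actAll-sumOver Dl classSeries allClasses n ⟩
  sumOver (λ c → actAll Dl (classSeries c) n) allClasses
    ≡⟨ sumOver-cong allClasses (λ {c} _ → class-identity c n) ⟩
  sumOver (λ c → coeff ⟦ classNumerator c ⟧ₚ n) allClasses
    ≡⟨ numerators-sum n ⟩
  coeff ⟦ numerator ⟧ₚ n ∎
  where
  open Series
  open Classes using (allClasses)
  open Symbolic x q
  open GeneratingFunction x q
  open ≡-Reasoning
  D  = mulP (mulP (mulP ⟦ Eₛ ⟧ₚ ⟦ Eₛ ⟧ₚ) ⟦ Eₛ ⟧ₚ) ⟦ Hₛ ⟧ₚ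
  F  = Fcoeff ((1 ∷ 2 ∷ 3 ∷ []) ∷ (3 ∷ 1 ∷ 2 ∷ []) ∷ []) x q
  Dl = map ⟦_⟧ₚ denominator
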